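{- Let $B$ be a length-$n$ 3OBP with a fixed decomposition $B=C_1\circ\cdots\circ C_l$ into chunks with coordinate sets $c_1,\dots,c_l$, let $k,\ell\in[n]$, let $m\ge k$ be an integer, and fix $t\subseteq[m]$ with $|t|=k$; let $g_t=\bigcup_{i\in[l]:\,(i\bmod m)+1\in t}c_i$. Then with probability at least $1-n\cdot2^{ -\ell(m-k)}$ over a uniformly random $x\in\{0,1\}^n$, the restricted program satisfies $B|_{\overline{g_t}\leftarrow x}=D_1\circ D_2\circ\cdots\circ D_r$, where $r\in[n]$, each $D_i$ is a 3OBP with at most $6\ell k$ non-regular layers, and each layer of vertices between $D_{i-1}$ and $D_i$ has width at most $2$.
   Context: An ordered branching program (OBP) $B=B_1\circ\cdots\circ B_n$ has vertex layers $V_0,\dots,V_n$ and layers $B_i:V_{i-1}\times\{0,1\}\to V_i$; a 3OBP has all $|V_i|\le3$; the width of a vertex layer is its number of vertices. In a concatenation $D_1\circ D_2$ the last vertex layer of $D_1$ is the first of $D_2$. Layer $i$ is regular if $|V_{i-1}|=|V_i|$ and $\mathbb{E}_U[B_i[U]]$ ($U$ a uniform bit, $B_i[b]$ the $0/1$ transition matrix) is doubly stochastic, non-regular otherwise. A chunk is a 3OBP with exactly one non-regular layer; the decomposition $B=C_1\circ\cdots\circ C_l$ splits the layers into consecutive blocks each containing exactly one non-regular layer, and $c_i\subseteq[n]$ is the set of layer indices in $C_i$. For $g\subseteq[n]$ and $x$, the restricted program $B|_{\overline g\leftarrow x}$ is the OBP reading only the bits in $g$, obtained from $B$ by fixing the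 input of every layer outside $g$ to the corresponding bit of $x$ (each fixed layer becoming a fixed map composed into the adjacent free layers), and then deleting every vertex that cannot be reached from the first layer of vertices. -}

module Defs where

open import Data.Nat using (ℕ; zero; suc; _+_; _≤_; _<_; _≡ᵇ_; _≤ᵇ_; _<ᵇ_)
open import Data.Nat.DivMod using (_mod_)
open import Data.Bool using (Bool; true; false; _∧_; _∨_; not; if_then_else_; T)
open import Data.Fin using (Fin; zero; suc; toℕ; inject₁; fromℕ)
import Data.Fin as F
open import Data.Fin.Subset using (Subset; ∣_∣; _∈_)
open import Data.Vec using (Vec; []; _∷_; lookup; tabulate; fromList)
import Data.Vec as V
open import Data.List using (List; []; _∷_; length)
open import Data.Product using (_×_; _,_; proj₁; proj₂; Σ; ∃)
open import Relation.Nullary.Decidable using (does)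
open import Relation.Binary.PropositionalEquality using (_≡_)

sumFin : ∀ {k} → (Fin k → ℕ) → ℕ
sumFin f = V.sum (tabulate f)

ind : Bool → ℕ
ind b = if b then 1 else 0

countFin : ∀ {k} → (Fin k → Bool) → ℕ
countFin p = sumFin (λ i → ind (p i))

allFin : ∀ {k} → (Fin k → Bool) → Bool
allFin p = countFin (λ i → not (p i)) ≡ᵇ 0

anyFin : ∀ {k} → (Fin k → Bool) → Bool
anyFin p = not (countFin p ≡ᵇ 0)

-- Every vertex layer has at most 3 vertices, so we label the
-- vertices of each layer by elements of Fin 3: vertex layer V_j is a
-- subset of Fin 3 and its width is the cardinality of that subset.
-- A layer is a map Fin 3 × {0,1} → Fin 3 (only its values on the
-- source vertex layer matter).

Layer : Set
Layer = Fin 3 → Bool → Fin 3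

-- An ordered branching program of length n with vertex layers
-- V_0 = V₀ and V_{i+1} = proj₂ (lookup layers i), and layer
-- B_{i+1} = proj₁ (lookup layers i)  (0-indexed layers).
record OBP (n : ℕ) : Set where
  constructor mkOBP
  field
    V₀     : Subset 3
    layers : Vec (Layer × Subset 3) n

vlayer : ∀ {n} → OBP n → Fin (suc n) → Subset 3
vlayer B zero    = OBP.V₀ B
vlayer B (suc j) = proj₂ (lookup (OBP.layers B) j)

trans : ∀ {n} → OBP n → Fin n → Layer
trans B i = proj₁ (lookup (OBP.layers B) i)

width : ∀ {n} → OBP n → Fin (suc n) → ℕ
width B j = ∣ vlayer B j ∣

WellFormed : ∀ {n} → OBP n → Set
WellFormed B = ∀ i u b → u ∈ vlayer B (inject₁ i) → trans B i u b ∈ vlayer B (suc i)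

-- Regularity.
-- (M_0 + M_1)[u][v] = number of bits b with f u b = v.
-- E_U[B_i[U]] = (M_0 + M_1)/2 is doubly stochastic  iff  every row and
-- every column of M_0 + M_1 (indexed by source/target vertex layers)
-- sums to 2 (entries are automatically nonnegative).

edgeCount : Layer → Fin 3 → Fin 3 → ℕ
edgeCount f u v = ind (does (f u false F.≟ v)) + ind (does (f u true F.≟ v))

doublyStochastic₂ : Subset 3 → Subset 3 → Layer → Bool
doublyStochastic₂ S T f =
  allFin (λ u → if lookup S u
                then sumFin (λ v → if lookup T v then edgeCount f u v else 0) ≡ᵇ 2
                else true)
  ∧ allFin (λ v → if lookup T v
                  then sumFin (λ u → if lookup S u then edgeCount f u v else 0) ≡ᵇ 2
                  else true)

regularᵇ : ∀ {n} → OBP n → Fin n → Bool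
regularᵇ B i = (width B (inject₁ i) ≡ᵇ width B (suc i))
               ∧ doublyStochastic₂ (vlayer B (inject₁ i)) (vlayer B (suc i)) (trans B i)

nonRegularBetween : ∀ {n} → OBP n → ℕ → ℕ → ℕ
nonRegularBetween B a b =
  countFin (λ i → (a ≤ᵇ toℕ i) ∧ (toℕ i <ᵇ b) ∧ not (regularᵇ B i))

-- Decomposition into chunks: layer i belongs to chunk (chunk i);
-- chunk is monotone (so the chunks are consecutive blocks, in order)
-- and each chunk contains exactly one non-regular layer.
-- The coordinate set c_j is { i | chunk i ≡ j }.

record ChunkDecomposition {n : ℕ} (B : OBP n) (l : ℕ) : Set where
  field
    chunk        : Fin n → Fin l
    monotone     : ∀ i j → toℕ i ≤ toℕ j → toℕ (chunk i) ≤ toℕ (chunk j)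
    oneNonRegular : ∀ (c : Fin l) →
      countFin (λ i → does (chunk i F.≟ c) ∧ not (regularᵇ B i)) ≡ 1

-- g_t = ⋃ { c_i | (i mod m) + 1 ∈ t }  (chunks 1-indexed, t ⊆ [m]);
-- with 0-indexed chunk j (i = j+1) and t as a subset of Fin m
-- (element e ∈ Fin m standing for e+1 ∈ [m]) this reads
-- ((j+1) mod m) ∈ t.  (m = 0 cannot occur since m ≥ k ≥ 1.)
gₜ : ∀ {n l} {B : OBP n} → ChunkDecomposition B l → (m : ℕ) → Subset m → Fin n → Bool
gₜ D zero    t i = false
gₜ D (suc m) t i = lookup t (suc (toℕ (ChunkDecomposition.chunk D i)) mod suc m)

-- Reachability is computed in the layered graph where free layers keep
-- both edges and fixed layers only the edge labelled by x.  Maximal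
-- blocks of fixed layers are composed into the preceding free layer
-- (a leading block into the first free layer).  Vertex layers of the
-- restricted program are the reachable parts of the original vertex
-- layers V_0 and V_e (e = index just before the next free layer, or n).

image : Subset 3 → (Fin 3 → Fin 3) → Subset 3
image R h = tabulate (λ v → anyFin (λ u → lookup R u ∧ does (h u F.≟ v)))

image₂ : Subset 3 → Layer → Subset 3
image₂ R f = tabulate (λ v → anyFin (λ u → lookup R u ∧
                        (does (f u false F.≟ v) ∨ does (f u true F.≟ v))))

-- after the first free layer: L = current composite layer, R = reachable set
phase₂ : ∀ {n} → Layer → Subset 3 → Vec (Layer × Subset 3) n → Vec Bool n → Vec Bool n
       → List (Layer × Subset 3)
phase₂ L R [] [] [] = (L , R) ∷ []
phase₂ L R ((f , _) ∷ ls) (false ∷ gs) (x ∷ xs) =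
  phase₂ (λ u b → f (L u b) x) (image R (λ u → f u x)) ls gs xs
phase₂ L R ((f , _) ∷ ls) (true ∷ gs) (x ∷ xs) =
  (L , R) ∷ phase₂ f (image₂ R f) ls gs xs

-- before the first free layer: pre = composite fixed map, R = reachable set
phase₁ : ∀ {n} → (Fin 3 → Fin 3) → Subset 3 → Vec (Layer × Subset 3) n → Vec Bool n → Vec Bool n
       → List (Layer × Subset 3)
phase₁ pre R [] [] [] = []
phase₁ pre R ((f , _) ∷ ls) (false ∷ gs) (x ∷ xs) =
  phase₁ (λ u → f (pre u) x) (image R (λ u → f u x)) ls gs xs
phase₁ pre R ((f , _) ∷ ls) (true ∷ gs) (x ∷ xs) =
  phase₂ (λ u b → f (pre u) b) (image₂ R f) ls gs xs

restrictLayers : ∀ {n} → OBP n → (Fin n → Bool) → Vec Bool n → List (Layer × Subset 3)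
restrictLayers B g x = phase₁ (λ u → u) (OBP.V₀ B) (OBP.layers B) (tabulate g) x

restrict : ∀ {n} (B : OBP n) (g : Fin n → Bool) (x : Vec Bool n)
         → OBP (length (restrictLayers B g x))
restrict B g x = mkOBP (OBP.V₀ B) (fromList (restrictLayers B g x))

-- R = D_1 ∘ ⋯ ∘ D_r with r ∈ [n], each D_j having at most `bound`
-- non-regular layers and each vertex layer between D_{j-1} and D_j
-- of width ≤ 2.  D_j consists of the layers i with
-- cuts (j-1) ≤ i < cuts j.

record Splits {N : ℕ} (n bound : ℕ) (R : OBP N) : Set where
  field
    r        : ℕ
    r≥1      : 1 ≤ r
    r≤n      : r ≤ n
    cuts     : Fin (suc r) → Fin (suc N)
    cuts-first : cuts zero ≡ zero
    cuts-last  : cuts (fromℕ r) ≡ fromℕ N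
    cuts-mono  : ∀ (j : Fin r) → toℕ (cuts (inject₁ j)) ≤ toℕ (cuts (suc j))
    pieces-nonreg : ∀ (j : Fin r) →
      nonRegularBetween R (toℕ (cuts (inject₁ j))) (toℕ (cuts (suc j))) ≤ bound
    boundary-width : ∀ (j : Fin (suc r)) → 0 < toℕ j → toℕ j < r → width R (cuts j) ≤ 2

-- Fix x and let R be the restricted program; its vertex layers are the sets of vertices of B reachable
-- under x. Cut R at every vertex layer of width at most 2. Inside a piece all vertex layers are full, so
-- every fixed layer of B met there is a permutation, and composing with permutations preserves
-- regularity: the non-regular layers of a piece come from free non-regular layers of B within a stretch
-- of full reachable sets. The non-regular layers of B lie in consecutive chunks, chunk i being free iff
-- (i mod m) + 1 ∈ t, so a stretch with f free and e fixed non-regular layers has f (m − k) ≤ k (e + m − k).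
-- A fixed non-regular layer inside the stretch is a permutation for the bit x assigns to it, which holds
-- for at most one of the two bits. So for each start a, the first ℓ (m − k) fixed non-regular layers
-- after a all become permutations with probability at most 2^(−ℓ (m − k)). Outside these n events every
-- stretch has e < ℓ (m − k), hence f ≤ k (ℓ + 1), and every piece has at most k (ℓ + 1) + 2 ≤ 6 ℓ k
-- non-regular layers.

module Submission where

open import Defs hiding (trans)

open import Data.Bool using (Bool; true; false; _∧_; _∨_; not; if_then_else_; T)
open import Data.Bool.Properties using (∧-conicalˡ; ∧-conicalʳ; ∧-zeroʳ; ∧-identityʳ; not-injective; T-≡; T?)
import Data.Bool.Properties as Bool
open import Data.Empty using (⊥-elim)
open import Data.Fin using (Fin; zero; suc; toℕ; fromℕ; fromℕ<; inject₁)
import Data.Fin as F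
open import Data.Fin.Properties using (toℕ-injective; toℕ-fromℕ; toℕ-fromℕ<; toℕ-inject₁; toℕ<n; fromℕ<-cong; fromℕ<-toℕ)
open import Data.Fin.Subset using (Subset; ∣_∣; ⊤; _∈_; _⊆_)
open import Data.List using (List; []; _∷_; map; _++_; length; filter; drop)
open import Data.List.Properties using (length-++; length-map; length-drop)
open import Data.List.Membership.Propositional using () renaming (_∈_ to _∈ₗ_)
open import Data.List.Membership.Propositional.Properties using (∈-map⁻)
open import Data.List.Relation.Unary.All using (All)
import Data.List.Relation.Unary.All as All
import Data.List.Relation.Unary.All.Properties as All
import Data.List.Relation.Unary.AllPairs as AllPairs
open import Data.List.Relation.Unary.Unique.Propositional using (Unique)
import Data.List.Relation.Unary.Unique.Propositional.Properties as Unique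
open import Data.Nat
open import Data.Nat.DivMod using (_mod_; _%_; _/_; m%n<n; m≡m%n+[m/n]*n; [m+n]%n≡m%n; m<n⇒m%n≡m)
open import Data.Nat.Properties
open import Algebra.Properties.CommutativeSemigroup +-commutativeSemigroup using (interchange)
open import Data.Nat.Tactic.RingSolver using (solve-∀)
open import Data.Product using (∃; Σ-syntax; _×_; _,_; proj₁; proj₂)
open import Data.Sum using (_⊎_; inj₁; inj₂; map₂)
open import Data.Unit using () renaming (⊤ to Unit)
open import Data.Vec using (Vec; []; _∷_; lookup; tabulate; fromList)
open import Data.Vec.Properties using (lookup∘tabulate; lookup-replicate; []=⇒lookup; lookup⇒[]=)
open import Function.Bundles using (Equivalence; mk⇔)
open import Relation.Binary.Definitions using (tri<; tri≈; tri>)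
open import Relation.Binary.PropositionalEquality
open import Relation.Nullary using (¬_; Dec; yes; no; does)
open import Relation.Nullary.Decidable using (dec-true; dec-false; does-⇔)

witness : ∀ {a} {A : Set a} (a? : Dec A) → does a? ≡ true → A
witness (yes a) _ = a

∧-true⁻ : ∀ {a b} → a ∧ b ≡ true → a ≡ true × b ≡ true
∧-true⁻ {a} {b} e = ∧-conicalˡ a b e , ∧-conicalʳ a b e

true≢false : true ≢ false
true≢false ()

sumRange : (ℕ → ℕ) → ℕ → ℕ → ℕ
sumRange f a zero    = 0
sumRange f a (suc d) = f a + sumRange f (suc a) d

countRange : (ℕ → Bool) → ℕ → ℕ → ℕ
countRange P = sumRange (λ j → ind (P j))

InRange : ℕ → ℕ → ℕ → Set
InRange a d j = a ≤ j × j < a + d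

private
  inRange-suc : ∀ {a d j} → InRange (suc a) d j → InRange a (suc d) j
  inRange-suc {a} {d} {j} (a<j , j<) = <⇒≤ a<j , subst (j <_) (sym (+-suc a d)) j<

  start-inRange : ∀ a d → InRange a (suc d) a
  start-inRange a d = ≤-refl , m<m+n a z<s

  inRange-tail : ∀ {a d j} → a < j → InRange a (suc d) j → InRange (suc a) d j
  inRange-tail {a} {d} {j} a<j (_ , j<) = a<j , subst (j <_) (+-suc a d) j<

sumRange-+ : ∀ f a d e → sumRange f a (d + e) ≡ sumRange f a d + sumRange f (a + d) e
sumRange-+ f a zero    e = cong (λ b → sumRange f b e) (sym (+-identityʳ a))
sumRange-+ f a (suc d) e = begin
  f a + sumRange f (suc a) (d + e)                   ≡⟨ cong (f a +_) (sumRange-+ f (suc a) d e) ⟩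
  f a + (sumRange f (suc a) d + sumRange f (suc a + d) e) ≡⟨ cong (λ b → f a + (sumRange f (suc a) d + sumRange f b e)) (sym (+-suc a d)) ⟩
  f a + (sumRange f (suc a) d + sumRange f (a + suc d) e) ≡⟨ sym (+-assoc (f a) _ _) ⟩
  f a + sumRange f (suc a) d + sumRange f (a + suc d) e ∎
  where open ≡-Reasoning

sumRange-suc : ∀ f a d → sumRange f a (suc d) ≡ sumRange f a d + f (a + d)
sumRange-suc f a d = begin
  sumRange f a (suc d)               ≡⟨ cong (sumRange f a) (+-comm 1 d) ⟩
  sumRange f a (d + 1)               ≡⟨ sumRange-+ f a d 1 ⟩
  sumRange f a d + (f (a + d) + 0)   ≡⟨ cong (sumRange f a d +_) (+-identityʳ _) ⟩
  sumRange f a d + f (a + d) ∎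
  where open ≡-Reasoning

sumRange-shift : ∀ f b a d → sumRange f (b + a) d ≡ sumRange (λ j → f (b + j)) a d
sumRange-shift f b a zero    = refl
sumRange-shift f b a (suc d) =
  cong (f (b + a) +_) (trans (cong (λ c → sumRange f c d) (sym (+-suc b a))) (sumRange-shift f b (suc a) d))

sumRange-cong : ∀ {f g} a d → (∀ j → InRange a d j → f j ≡ g j) → sumRange f a d ≡ sumRange g a d
sumRange-cong a zero    eq = refl
sumRange-cong a (suc d) eq =
  cong₂ _+_ (eq a (start-inRange a d)) (sumRange-cong (suc a) d (λ j r → eq j (inRange-suc r)))

sumRange-zero : ∀ {f} a d → (∀ j → InRange a d j → f j ≡ 0) → sumRange f a d ≡ 0
sumRange-zero a zero    eq = refl
sumRange-zero a (suc d) eq =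
  cong₂ _+_ (eq a (start-inRange a d)) (sumRange-zero (suc a) d (λ j r → eq j (inRange-suc r)))

sumRange-bound : ∀ f X Y a d → (∀ j → f j * X ≤ Y) → sumRange f a d * X ≤ d * Y
sumRange-bound f X Y a zero    le = z≤n
sumRange-bound f X Y a (suc d) le =
  ≤-trans (≤-reflexive (*-distribʳ-+ X (f a) _)) (+-mono-≤ (le a) (sumRange-bound f X Y (suc a) d le))

term≤sumRange : ∀ f a d j → InRange a d j → f j ≤ sumRange f a d
term≤sumRange f a zero    j (a≤j , j<a+0) = ⊥-elim (<-irrefl refl (≤-trans j<a+0 (subst (_≤ j) (sym (+-identityʳ a)) a≤j)))
term≤sumRange f a (suc d) j r@(a≤j , _) with m≤n⇒m<n∨m≡n a≤j
... | inj₂ refl = m≤m+n (f a) _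
... | inj₁ a<j  = ≤-trans (term≤sumRange f (suc a) d j (inRange-tail a<j r)) (m≤n+m _ (f a))

two-terms≤sumRange : ∀ f a d j j' → j < j' → InRange a d j → InRange a d j' → f j + f j' ≤ sumRange f a d
two-terms≤sumRange f a zero    j j' _ (a≤j , j<a+0) _ = ⊥-elim (<-irrefl refl (≤-trans j<a+0 (subst (_≤ j) (sym (+-identityʳ a)) a≤j)))
two-terms≤sumRange f a (suc d) j j' j<j' r@(a≤j , _) r' with m≤n⇒m<n∨m≡n a≤j
... | inj₂ refl = +-monoʳ-≤ (f a) (term≤sumRange f (suc a) d j' (inRange-tail j<j' r'))
... | inj₁ a<j  = ≤-trans (two-terms≤sumRange f (suc a) d j j' j<j' (inRange-tail a<j r) (inRange-tail (<-trans a<j j<j') r'))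
                          (m≤n+m _ (f a))

ind≤1 : ∀ b → ind b ≤ 1
ind≤1 true  = s≤s z≤n
ind≤1 false = z≤n

countRange≤ : ∀ P a d → countRange P a d ≤ d
countRange≤ P a zero    = z≤n
countRange≤ P a (suc d) = +-mono-≤ (ind≤1 (P a)) (countRange≤ P (suc a) d)

countRange-+-not : ∀ P a d → countRange P a d + countRange (λ j → not (P j)) a d ≡ d
countRange-+-not P a zero    = refl
countRange-+-not P a (suc d) with P a
... | true  = cong suc (countRange-+-not P (suc a) d)
... | false = trans (+-suc _ _) (cong suc (countRange-+-not P (suc a) d))

countRange-monoʳ : ∀ P a {d e} → d ≤ e → countRange P a d ≤ countRange P a e
countRange-monoʳ P a {d} {e} d≤e = begin
  countRange P a d                                        ≤⟨ m≤m+n _ _ ⟩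
  countRange P a d + countRange P (a + d) (e ∸ d)         ≡⟨ sym (sumRange-+ _ a d (e ∸ d)) ⟩
  countRange P a (d + (e ∸ d))                            ≡⟨ cong (countRange P a) (m+[n∸m]≡n d≤e) ⟩
  countRange P a e ∎
  where open ≤-Reasoning

countRange-⊆ : ∀ P a d n → a + d ≤ n → countRange P a d ≤ countRange P 0 n
countRange-⊆ P a d n a+d≤n = begin
  countRange P a d                          ≤⟨ m≤n+m _ (countRange P 0 a) ⟩
  countRange P 0 a + countRange P a d       ≡⟨ sym (sumRange-+ _ 0 a d) ⟩
  countRange P 0 (a + d)                    ≤⟨ countRange-monoʳ P 0 a+d≤n ⟩
  countRange P 0 n ∎
  where open ≤-Reasoning

countFin≡countRange : ∀ {n} (p : Fin n → Bool) (P : ℕ → Bool) a → (∀ i → p i ≡ P (a + toℕ i)) → countFin p ≡ countRange P a n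
countFin≡countRange {zero}  p P a eq = refl
countFin≡countRange {suc n} p P a eq =
  cong₂ _+_ (cong ind (trans (eq zero) (cong P (+-identityʳ a))))
            (countFin≡countRange (λ i → p (suc i)) P (suc a) (λ i → trans (eq (suc i)) (cong P (+-suc a (toℕ i)))))

two≤countRange : ∀ P a d {j j'} → j < j' → InRange a d j → InRange a d j' → P j ≡ true → P j' ≡ true → 2 ≤ countRange P a d
two≤countRange P a d j<j' r r' Pj Pj' =
  subst₂ (λ x y → x + y ≤ countRange P a d) (cong ind Pj) (cong ind Pj') (two-terms≤sumRange _ a d _ _ j<j' r r')

private
  2≰1 : ¬ 2 ≤ 1
  2≰1 (s≤s ())

countRange-pos : ∀ P a d → 1 ≤ countRange P a d → Σ[ j ∈ ℕ ] InRange a d j × P j ≡ true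
countRange-pos P a (suc d) pos with P a in eq
... | true  = a , start-inRange a d , eq
... | false with countRange-pos P (suc a) d pos
...   | j , r , Pj = j , inRange-suc r , Pj

countRange≡0 : ∀ P a d → countRange P a d ≡ 0 → ∀ j → InRange a d j → P j ≡ false
countRange≡0 P a d none j r with P j in eq
... | false = refl
... | true  = ⊥-elim (<-irrefl refl (≤-trans (subst (_≤ countRange P a d) (cong ind eq) (term≤sumRange _ a d j r)) (≤-reflexive none)))

countRange≡1 : ∀ P a d → countRange P a d ≡ 1 → ∀ j j' → InRange a d j → InRange a d j' → P j ≡ true → P j' ≡ true → j ≡ j'
countRange≡1 P a d one j j' r r' Pj Pj' with <-cmp j j'
... | tri≈ _ j≡j' _ = j≡j'
... | tri< j<j' _ _ = ⊥-elim (2≰1 (subst (2 ≤_) one (two≤countRange P a d j<j' r r' Pj Pj')))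
... | tri> _ _ j'<j = ⊥-elim (2≰1 (subst (2 ≤_) one (two≤countRange P a d j'<j r' r Pj' Pj)))

allFin-sound : ∀ {k} (p : Fin k → Bool) → allFin p ≡ true → ∀ i → p i ≡ true
allFin-sound {suc k} p all i with p zero in p0
allFin-sound {suc k} p all zero    | true = p0
allFin-sound {suc k} p all (suc i) | true = allFin-sound (λ j → p (suc j)) all i

allFin-complete : ∀ {k} (p : Fin k → Bool) → (∀ i → p i ≡ true) → allFin p ≡ true
allFin-complete {zero}  p all = refl
allFin-complete {suc k} p all rewrite all zero = allFin-complete (λ j → p (suc j)) (λ j → all (suc j))

anyFin-sound : ∀ {k} (p : Fin k → Bool) → anyFin p ≡ true → Σ[ i ∈ Fin k ] p i ≡ true
anyFin-sound {suc k} p any with p zero in p0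
... | true  = zero , p0
... | false with anyFin-sound (λ j → p (suc j)) any
...   | i , pi = suc i , pi

sumFin-+ : ∀ {k} (f g : Fin k → ℕ) → sumFin (λ i → f i + g i) ≡ sumFin f + sumFin g
sumFin-+ {zero}  f g = refl
sumFin-+ {suc k} f g = trans (cong (f zero + g zero +_) (sumFin-+ (λ i → f (suc i)) (λ i → g (suc i))))
                             (interchange (f zero) (g zero) _ _)

sumFin-cong : ∀ {k} {f g : Fin k → ℕ} → (∀ i → f i ≡ g i) → sumFin f ≡ sumFin g
sumFin-cong {zero}  eq = refl
sumFin-cong {suc k} eq = cong₂ _+_ (eq zero) (sumFin-cong (λ i → eq (suc i)))

isFull : Subset 3 → Bool
isFull (a ∷ b ∷ c ∷ []) = a ∧ b ∧ c

isFull⇒≡⊤ : ∀ S → isFull S ≡ true → S ≡ ⊤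
isFull⇒≡⊤ (true ∷ true ∷ true ∷ []) _ = refl

¬isFull⇒∣∣≤2 : ∀ S → isFull S ≡ false → ∣ S ∣ ≤ 2
¬isFull⇒∣∣≤2 (true  ∷ true  ∷ false ∷ []) _ = s≤s (s≤s z≤n)
¬isFull⇒∣∣≤2 (true  ∷ false ∷ true  ∷ []) _ = s≤s (s≤s z≤n)
¬isFull⇒∣∣≤2 (true  ∷ false ∷ false ∷ []) _ = s≤s z≤n
¬isFull⇒∣∣≤2 (false ∷ true  ∷ true  ∷ []) _ = s≤s (s≤s z≤n)
¬isFull⇒∣∣≤2 (false ∷ true  ∷ false ∷ []) _ = s≤s z≤n
¬isFull⇒∣∣≤2 (false ∷ false ∷ true  ∷ []) _ = s≤s z≤n
¬isFull⇒∣∣≤2 (false ∷ false ∷ false ∷ []) _ = z≤n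

isFull-⊆ : ∀ R S → R ⊆ S → isFull R ≡ true → isFull S ≡ true
isFull-⊆ R S@(_ ∷ _ ∷ _ ∷ []) R⊆S full with isFull⇒≡⊤ R full
... | refl = cong₂ _∧_ (mem zero) (cong₂ _∧_ (mem (suc zero)) (mem (suc (suc zero))))
  where
  mem : ∀ u → lookup S u ≡ true
  mem u = []=⇒lookup (R⊆S (lookup⇒[]= u ⊤ (lookup-replicate u true)))

image-∈⁻ : ∀ R h v → lookup (image R h) v ≡ true → Σ[ u ∈ Fin 3 ] u ∈ R × h u ≡ v
image-∈⁻ R h v v∈
  with anyFin-sound _ (trans (sym (lookup∘tabulate (λ w → anyFin (λ u → lookup R u ∧ does (h u F.≟ w))) v)) v∈)
... | u , hit with ∧-true⁻ {lookup R u} hit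
...   | u∈R , hu≡v = u , lookup⇒[]= u R u∈R , witness (h u F.≟ v) hu≡v

private
  edge-label : ∀ (g : Bool → Fin 3) v → does (g false F.≟ v) ∨ does (g true F.≟ v) ≡ true → Σ[ b ∈ Bool ] g b ≡ v
  edge-label g v e with g false F.≟ v
  ... | yes g0≡v = false , g0≡v
  ... | no _     = true , witness (g true F.≟ v) e

image₂-∈⁻ : ∀ R f v → lookup (image₂ R f) v ≡ true → Σ[ u ∈ Fin 3 ] u ∈ R × Σ[ b ∈ Bool ] f u b ≡ v
image₂-∈⁻ R f v v∈
  with anyFin-sound _ (trans (sym (lookup∘tabulate (λ w → anyFin (λ u → lookup R u ∧ (does (f u false F.≟ w) ∨ does (f u true F.≟ w)))) v)) v∈)
... | u , hit with ∧-true⁻ {lookup R u} hit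
...   | u∈R , edge = u , lookup⇒[]= u R u∈R , edge-label (f u) v edge

regularLayer : Subset 3 → Layer → Subset 3 → Bool
regularLayer S f T = (∣ S ∣ ≡ᵇ ∣ T ∣) ∧ doublyStochastic₂ S T f

outDegree : Layer → Fin 3 → ℕ
outDegree f u = sumFin (λ v → edgeCount f u v)

inDegree : Layer → Fin 3 → ℕ
inDegree f v = sumFin (λ u → edgeCount f u v)

fiber : (Fin 3 → Fin 3) → Fin 3 → ℕ
fiber h v = sumFin (λ u → ind (does (h u F.≟ v)))

sumFin-≟ˡ : ∀ (w : Fin 3) → sumFin (λ v → ind (does (w F.≟ v))) ≡ 1
sumFin-≟ˡ zero             = refl
sumFin-≟ˡ (suc zero)       = refl
sumFin-≟ˡ (suc (suc zero)) = refl

sumFin-≟ʳ : ∀ (w : Fin 3) → sumFin (λ v → ind (does (v F.≟ w))) ≡ 1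
sumFin-≟ʳ zero             = refl
sumFin-≟ʳ (suc zero)       = refl
sumFin-≟ʳ (suc (suc zero)) = refl

outDegree≡2 : ∀ f u → outDegree f u ≡ 2
outDegree≡2 f u = trans (sumFin-+ (λ v → ind (does (f u false F.≟ v))) (λ v → ind (does (f u true F.≟ v))))
                         (cong₂ _+_ (sumFin-≟ˡ (f u false)) (sumFin-≟ˡ (f u true)))

inDegree≡fiber+fiber : ∀ f v → inDegree f v ≡ fiber (λ u → f u false) v + fiber (λ u → f u true) v
inDegree≡fiber+fiber f v = sumFin-+ (λ u → ind (does (f u false F.≟ v))) (λ u → ind (does (f u true F.≟ v)))

private
  regular⊤≡ : ∀ f → regularLayer ⊤ f ⊤ ≡ allFin (λ u → outDegree f u ≡ᵇ 2) ∧ allFin (λ v → inDegree f v ≡ᵇ 2)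
  regular⊤≡ f = refl

regular⊤⇒inDegree≡2 : ∀ f → regularLayer ⊤ f ⊤ ≡ true → ∀ v → inDegree f v ≡ 2
regular⊤⇒inDegree≡2 f reg v =
  ≡ᵇ⇒≡ _ 2 (Equivalence.from T-≡ (allFin-sound (λ w → inDegree f w ≡ᵇ 2)
    (proj₂ (∧-true⁻ {allFin (λ u → outDegree f u ≡ᵇ 2)} (trans (sym (regular⊤≡ f)) reg))) v))

inDegree≡2⇒regular⊤ : ∀ f → (∀ v → inDegree f v ≡ 2) → regularLayer ⊤ f ⊤ ≡ true
inDegree≡2⇒regular⊤ f in2 = trans (regular⊤≡ f) (cong₂ _∧_
  (allFin-complete (λ u → outDegree f u ≡ᵇ 2) (λ u → Equivalence.to T-≡ (≡⇒≡ᵇ _ 2 (outDegree≡2 f u))))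
  (allFin-complete (λ v → inDegree f v ≡ᵇ 2) (λ v → Equivalence.to T-≡ (≡⇒≡ᵇ _ 2 (in2 v)))))

Onto : (Fin 3 → Fin 3) → Set
Onto h = isFull (image ⊤ h) ≡ true

preimage : (Fin 3 → Fin 3) → Fin 3 → Fin 3
preimage h v = if does (h zero F.≟ v) then zero else if does (h (suc zero) F.≟ v) then suc zero else suc (suc zero)

-- Statements about all maps Fin 3 → Fin 3 are checked on their 27 tables: for a Boolean property p that
-- only evaluates h at 0, 1, 2, the terms p h and p (table (h 0) (h 1) (h 2)) are definitionally equal.
private
  table : Fin 3 → Fin 3 → Fin 3 → Fin 3 → Fin 3
  table a b c zero             = a
  table a b c (suc zero)       = b
  table a b c (suc (suc zero)) = c

  allMaps : ((Fin 3 → Fin 3) → Bool) → Bool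
  allMaps p = allFin λ a → allFin λ b → allFin λ c → p (table a b c)

  allMaps-sound : ∀ p → allMaps p ≡ true → ∀ (h : Fin 3 → Fin 3) → p (table (h zero) (h (suc zero)) (h (suc (suc zero)))) ≡ true
  allMaps-sound p all h =
    allFin-sound (λ c → p (table a b c)) (allFin-sound (λ b → allFin λ c → p (table a b c))
      (allFin-sound (λ a → allFin λ b → allFin λ c → p (table a b c)) all a) b) (h (suc (suc zero)))
    where
    a = h zero
    b = h (suc zero)

  allBools : (Bool → Bool) → Bool
  allBools p = p false ∧ p true

  allBools-sound : ∀ p → allBools p ≡ true → ∀ b → p b ≡ true
  allBools-sound p all false = proj₁ (∧-true⁻ all)
  allBools-sound p all true  = proj₂ (∧-true⁻ all)

  if-true : ∀ {c x} → c ≡ true → (if c then x else true) ≡ true → x ≡ true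
  if-true refl e = e

  invertsAtᵇ : (Fin 3 → Fin 3) → Fin 3 → Fin 3 → Bool
  invertsAtᵇ h v y = does (does (h y F.≟ v) Bool.≟ does (y F.≟ preimage h v))

  invertsᵇ : (Fin 3 → Fin 3) → Bool
  invertsᵇ h = if isFull (image ⊤ h) then allFin (λ v → allFin (invertsAtᵇ h v)) else true

  reflectsFullᵇ : Subset 3 → (Fin 3 → Fin 3) → Bool
  reflectsFullᵇ R h = if isFull (image R h) then isFull R else true

onto-preimage : ∀ h → Onto h → ∀ v y → does (h y F.≟ v) ≡ does (y F.≟ preimage h v)
onto-preimage h onto v y = witness (_ Bool.≟ _)
  (allFin-sound (invertsAtᵇ h v) (allFin-sound (λ w → allFin (invertsAtᵇ h w)) (if-true onto inverts) v) y)
  where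
  inverts : invertsᵇ h ≡ true
  inverts = allMaps-sound invertsᵇ refl h

isFull-image⇒isFull : ∀ R h → isFull (image R h) ≡ true → isFull R ≡ true
isFull-image⇒isFull R@(r₀ ∷ r₁ ∷ r₂ ∷ []) h full = if-true full reflects
  where
  checkedᵇ : Bool → Bool → Bool → Bool
  checkedᵇ r₀ r₁ r₂ = allMaps (reflectsFullᵇ (r₀ ∷ r₁ ∷ r₂ ∷ []))
  reflects : reflectsFullᵇ R h ≡ true
  reflects = allMaps-sound (reflectsFullᵇ R)
    (allBools-sound (checkedᵇ r₀ r₁) (allBools-sound (λ r₁ → allBools (checkedᵇ r₀ r₁))
      (allBools-sound (λ r₀ → allBools (λ r₁ → allBools (checkedᵇ r₀ r₁))) refl r₀) r₁) r₂) h

fiber-onto : ∀ h → Onto h → ∀ v → fiber h v ≡ 1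
fiber-onto h onto v = trans (sumFin-cong (λ u → cong ind (onto-preimage h onto v u))) (sumFin-≟ʳ (preimage h v))

inDegree-∘onto : ∀ h L → Onto h → ∀ v → inDegree (λ u b → h (L u b)) v ≡ inDegree L (preimage h v)
inDegree-∘onto h L onto v = sumFin-cong (λ u →
  cong₂ _+_ (cong ind (onto-preimage h onto v (L u false))) (cong ind (onto-preimage h onto v (L u true))))

bothOnto⇒inDegree≡2 : ∀ f → Onto (λ u → f u false) → Onto (λ u → f u true) → ∀ v → inDegree f v ≡ 2
bothOnto⇒inDegree≡2 f onto₀ onto₁ v =
  trans (inDegree≡fiber+fiber f v) (cong₂ _+_ (fiber-onto (λ u → f u false) onto₀ v) (fiber-onto (λ u → f u true) onto₁ v))

allVecs : ∀ n → List (Vec Bool n)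
allVecs zero    = [] ∷ []
allVecs (suc n) = map (true ∷_) (allVecs n) ++ map (false ∷_) (allVecs n)

length-allVecs : ∀ n → length (allVecs n) ≡ 2 ^ n
length-allVecs zero    = refl
length-allVecs (suc n) = begin
  length (map (true ∷_) (allVecs n) ++ map (false ∷_) (allVecs n))  ≡⟨ length-++ (map (true ∷_) (allVecs n)) ⟩
  length (map (true ∷_) (allVecs n)) + length (map (false ∷_) (allVecs n))
                                                                     ≡⟨ cong₂ _+_ (length-map _ (allVecs n)) (length-map _ (allVecs n)) ⟩
  length (allVecs n) + length (allVecs n)                            ≡⟨ cong (λ m → m + m) (length-allVecs n) ⟩
  2 ^ n + 2 ^ n                                                      ≡⟨ cong (2 ^ n +_) (sym (+-identityʳ (2 ^ n))) ⟩
  2 ^ suc n ∎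
  where open ≡-Reasoning

allVecs-unique : ∀ n → Unique (allVecs n)
allVecs-unique zero    = All.[] AllPairs.∷ AllPairs.[]
allVecs-unique (suc n) = Unique.++⁺ (Unique.map⁺ ∷-injectiveʳ (allVecs-unique n)) (Unique.map⁺ ∷-injectiveʳ (allVecs-unique n)) disjoint
  where
  ∷-injectiveʳ : ∀ {b} {x y : Vec Bool n} → b ∷ x ≡ b ∷ y → x ≡ y
  ∷-injectiveʳ refl = refl
  disjoint : ∀ {v} → ¬ (v ∈ₗ map (true ∷_) (allVecs n) × v ∈ₗ map (false ∷_) (allVecs n))
  disjoint (v∈₁ , v∈₀) with ∈-map⁻ (true ∷_) v∈₁ | ∈-map⁻ (false ∷_) v∈₀
  ... | _ , _ , refl | _ , _ , ()

sumList : ∀ {A : Set} → (A → ℕ) → List A → ℕ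
sumList f []       = 0
sumList f (x ∷ xs) = f x + sumList f xs

sumList-++ : ∀ {A : Set} (f : A → ℕ) xs ys → sumList f (xs ++ ys) ≡ sumList f xs + sumList f ys
sumList-++ f []       ys = refl
sumList-++ f (x ∷ xs) ys = trans (cong (f x +_) (sumList-++ f xs ys)) (sym (+-assoc (f x) _ _))

sumList-map : ∀ {A B : Set} (f : B → ℕ) (g : A → B) xs → sumList f (map g xs) ≡ sumList (λ x → f (g x)) xs
sumList-map f g []       = refl
sumList-map f g (x ∷ xs) = cong (f (g x) +_) (sumList-map f g xs)

sumList-mono : ∀ {A : Set} {f g : A → ℕ} xs → (∀ x → f x ≤ g x) → sumList f xs ≤ sumList g xs
sumList-mono []       le = z≤n
sumList-mono (x ∷ xs) le = +-mono-≤ (le x) (sumList-mono xs le)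

sumList-0 : ∀ {A : Set} (xs : List A) → sumList (λ _ → 0) xs ≡ 0
sumList-0 []       = refl
sumList-0 (x ∷ xs) = sumList-0 xs

sumList-ind-∧ : ∀ {A : Set} b (P : A → Bool) xs → sumList (λ x → ind (b ∧ P x)) xs ≡ ind b * sumList (λ x → ind (P x)) xs
sumList-ind-∧ true  P xs = sym (+-identityʳ _)
sumList-ind-∧ false P xs = sumList-0 xs

sumList-sumRange : ∀ {A : Set} (h : ℕ → A → ℕ) xs a d →
  sumList (λ x → sumRange (λ j → h j x) a d) xs ≡ sumRange (λ j → sumList (h j) xs) a d
sumList-sumRange h []       a d = sym (sumRange-zero a d (λ _ _ → refl))
sumList-sumRange h (x ∷ xs) a d =
  trans (cong (sumRange (λ j → h j x) a d +_) (sumList-sumRange h xs a d)) (sumRange-+-pointwise a d)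
  where
  sumRange-+-pointwise : ∀ a d → sumRange (λ j → h j x) a d + sumRange (λ j → sumList (h j) xs) a d
                                ≡ sumRange (λ j → h j x + sumList (h j) xs) a d
  sumRange-+-pointwise a zero    = refl
  sumRange-+-pointwise a (suc d) =
    trans (interchange (h a x) _ (sumList (h a) xs) _) (cong (h a x + sumList (h a) xs +_) (sumRange-+-pointwise (suc a) d))

length-filter≡sumList : ∀ {A : Set} (p : A → Bool) xs → length (filter (λ x → T? (p x)) xs) ≡ sumList (λ x → ind (p x)) xs
length-filter≡sumList p []       = refl
length-filter≡sumList p (x ∷ xs) with p x
... | true  = cong suc (length-filter≡sumList p xs)
... | false = length-filter≡sumList p xs

sumList-ind-+-not : ∀ {A : Set} (p : A → Bool) xs → sumList (λ x → ind (p x)) xs + sumList (λ x → ind (not (p x))) xs ≡ length xs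
sumList-ind-+-not p []       = refl
sumList-ind-+-not p (x ∷ xs) with p x
... | true  = cong suc (sumList-ind-+-not p xs)
... | false = trans (+-suc _ _) (cong suc (sumList-ind-+-not p xs))

admissible : ∀ {n} → (ℕ → Bool → Bool) → ℕ → Vec Bool n → Bool
admissible P o []      = true
admissible P o (b ∷ y) = P o b ∧ admissible P (suc o) y

admissible-intro : ∀ {n} P o (y : Vec Bool n) → (∀ i → P (o + toℕ i) (lookup y i) ≡ true) → admissible P o y ≡ true
admissible-intro P o []      ok = refl
admissible-intro P o (b ∷ y) ok =
  cong₂ _∧_ (trans (cong (λ j → P j b) (sym (+-identityʳ o))) (ok zero))
            (admissible-intro P (suc o) y (λ i → trans (cong (λ j → P j (lookup y i)) (sym (+-suc o _))) (ok (suc i))))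

-- Each position j with Q j allows at most one bit, which halves the number of admissible vectors.
admissible-count : ∀ n o (P : ℕ → Bool → Bool) (Q : ℕ → Bool) → (∀ j → Q j ≡ true → ind (P j true) + ind (P j false) ≤ 1)
  → sumList (λ y → ind (admissible P o y)) (allVecs n) * 2 ^ countRange Q o n ≤ 2 ^ n
admissible-count zero    o P Q one = ≤-refl
admissible-count (suc n) o P Q one = begin
  sumList (λ y → ind (admissible P o y)) (allVecs (suc n)) * 2 ^ countRange Q o (suc n) ≡⟨ cong (_* 2 ^ (ind (Q o) + C)) split ⟩
  (c * S) * 2 ^ (ind (Q o) + C)                                                       ≤⟨ step (Q o) refl ⟩
  2 ^ suc n ∎
  where
  open ≤-Reasoning
  S = sumList (λ y → ind (admissible P (suc o) y)) (allVecs n)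
  C = countRange Q (suc o) n
  c = ind (P o true) + ind (P o false)
  IH : S * 2 ^ C ≤ 2 ^ n
  IH = admissible-count n (suc o) P Q one
  rearrange : ∀ c S X → c * S * (2 * X) ≡ c * (2 * (S * X))
  rearrange = solve-∀
  split : sumList (λ y → ind (admissible P o y)) (allVecs (suc n)) ≡ c * S
  split = begin-equality
    sumList (λ y → ind (admissible P o y)) (map (true ∷_) (allVecs n) ++ map (false ∷_) (allVecs n))
      ≡⟨ sumList-++ _ (map (true ∷_) (allVecs n)) _ ⟩
    sumList (λ y → ind (admissible P o y)) (map (true ∷_) (allVecs n)) + sumList (λ y → ind (admissible P o y)) (map (false ∷_) (allVecs n))
      ≡⟨ cong₂ _+_ (trans (sumList-map _ _ (allVecs n)) (sumList-ind-∧ (P o true) _ (allVecs n)))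
                   (trans (sumList-map _ _ (allVecs n)) (sumList-ind-∧ (P o false) _ (allVecs n))) ⟩
    ind (P o true) * S + ind (P o false) * S
      ≡⟨ sym (*-distribʳ-+ S (ind (P o true)) (ind (P o false))) ⟩
    c * S ∎
  step : ∀ q → Q o ≡ q → (c * S) * 2 ^ (ind q + C) ≤ 2 ^ suc n
  step true  Qo = begin
    (c * S) * (2 * 2 ^ C) ≡⟨ rearrange c S (2 ^ C) ⟩
    c * (2 * (S * 2 ^ C)) ≤⟨ *-mono-≤ (one o Qo) (*-monoʳ-≤ 2 IH) ⟩
    1 * 2 ^ suc n         ≡⟨ *-identityˡ _ ⟩
    2 ^ suc n ∎
  step false _  = begin
    (c * S) * 2 ^ C ≡⟨ *-assoc c S _ ⟩
    c * (S * 2 ^ C) ≤⟨ *-mono-≤ (+-mono-≤ (ind≤1 (P o true)) (ind≤1 (P o false))) IH ⟩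
    2 * 2 ^ n ∎

lookupOr : ∀ {A : Set} {k} → Vec A k → A → ℕ → A
lookupOr []      d q       = d
lookupOr (a ∷ v) d zero    = a
lookupOr (a ∷ v) d (suc q) = lookupOr v d q

lookup≡lookupOr : ∀ {A : Set} {k} (v : Vec A k) d (i : Fin k) → lookup v i ≡ lookupOr v d (toℕ i)
lookup≡lookupOr (a ∷ v) d zero    = refl
lookup≡lookupOr (a ∷ v) d (suc i) = lookup≡lookupOr v d i

lookupOr-tabulate : ∀ {A : Set} {k} (f : Fin k → A) d q (q<k : q < k) → lookupOr (tabulate f) d q ≡ f (fromℕ< q<k)
lookupOr-tabulate {k = suc k} f d zero    _         = refl
lookupOr-tabulate {k = suc k} f d (suc q) (s≤s q<k) = lookupOr-tabulate (λ i → f (suc i)) d q q<k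

freeAt : ∀ {n} → (Fin n → Bool) → ℕ → Bool
freeAt g = lookupOr (tabulate g) false

module ProgramView {n} (B : OBP n) where

  private
    padding : Layer × Subset 3
    padding = (λ u b → u) , ⊤

  entry : ℕ → Layer × Subset 3
  entry = lookupOr (OBP.layers B) padding

  lookup≡entry : ∀ i → lookup (OBP.layers B) i ≡ entry (toℕ i)
  lookup≡entry = lookup≡lookupOr (OBP.layers B) padding

  layer : ℕ → Layer
  layer q = proj₁ (entry q)

  vertices : ℕ → Subset 3
  vertices zero    = OBP.V₀ B
  vertices (suc q) = proj₂ (entry q)

  nonRegular : ℕ → Bool
  nonRegular q = not (regularLayer (vertices q) (layer q) (vertices (suc q)))

  vlayer≡vertices : ∀ (j : Fin (suc n)) → vlayer B j ≡ vertices (toℕ j)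
  vlayer≡vertices zero    = refl
  vlayer≡vertices (suc j) = cong proj₂ (lookup≡entry j)

  nonRegular≡ : ∀ (i : Fin n) → not (regularᵇ B i) ≡ nonRegular (toℕ i)
  nonRegular≡ i = cong not (cong₂ (λ S (LT : Layer × Subset 3) → regularLayer S (proj₁ LT) (proj₂ LT))
    (trans (vlayer≡vertices (inject₁ i)) (cong vertices (toℕ-inject₁ i))) (lookup≡entry i))

  nonRegularBetween≡countRange : ∀ a b → a ≤ b → b ≤ n → nonRegularBetween B a b ≡ countRange nonRegular a (b ∸ a)
  nonRegularBetween≡countRange a b a≤b b≤n = begin
    nonRegularBetween B a b
      ≡⟨ countFin≡countRange _ inWindow 0 (λ i → cong (λ z → (a ≤ᵇ toℕ i) ∧ (toℕ i <ᵇ b) ∧ z) (nonRegular≡ i)) ⟩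
    countRange inWindow 0 n
      ≡⟨ cong (countRange inWindow 0) (sym (trans (sym (+-assoc a (b ∸ a) (n ∸ b))) (trans (cong (_+ (n ∸ b)) (m+[n∸m]≡n a≤b)) (m+[n∸m]≡n b≤n)))) ⟩
    countRange inWindow 0 (a + ((b ∸ a) + (n ∸ b)))
      ≡⟨ trans (sumRange-+ _ 0 a _) (cong (countRange inWindow 0 a +_) (sumRange-+ _ a (b ∸ a) (n ∸ b))) ⟩
    countRange inWindow 0 a + (countRange inWindow a (b ∸ a) + countRange inWindow (a + (b ∸ a)) (n ∸ b))
      ≡⟨ cong₂ _+_ below (cong₂ _+_ inside above) ⟩
    0 + (countRange nonRegular a (b ∸ a) + 0)
      ≡⟨ +-identityʳ _ ⟩
    countRange nonRegular a (b ∸ a) ∎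
    where
    open ≡-Reasoning
    inWindow : ℕ → Bool
    inWindow q = (a ≤ᵇ q) ∧ (q <ᵇ b) ∧ nonRegular q
    below : countRange inWindow 0 a ≡ 0
    below = sumRange-zero 0 a (λ q (_ , q<a) → cong ind (cong (_∧ _) (dec-false (a ≤? q) (<⇒≱ q<a))))
    inside : countRange inWindow a (b ∸ a) ≡ countRange nonRegular a (b ∸ a)
    inside = sumRange-cong a (b ∸ a) (λ q (a≤q , q<) →
      cong ind (cong₂ (λ s t → s ∧ t ∧ nonRegular q) (dec-true (a ≤? q) a≤q) (dec-true (q <? b) (subst (q <_) (m+[n∸m]≡n a≤b) q<))))
    above : countRange inWindow (a + (b ∸ a)) (n ∸ b) ≡ 0
    above = sumRange-zero _ (n ∸ b) (λ q (b≤q , _) →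
      cong ind (trans (cong (λ t → (a ≤ᵇ q) ∧ t ∧ nonRegular q) (dec-false (q <? b) (≤⇒≯ (subst (_≤ q) (m+[n∸m]≡n a≤b) b≤q))))
                      (∧-zeroʳ (a ≤ᵇ q))))

  layer-∈ : WellFormed B → ∀ q → q < n → ∀ u b → u ∈ vertices q → layer q u b ∈ vertices (suc q)
  layer-∈ wf q q<n u b u∈ = subst₂ (λ L V → L u b ∈ V) layer≡ target≡ (wf i u b (subst (u ∈_) (sym source≡) u∈))
    where
    i = fromℕ< q<n
    ti : toℕ i ≡ q
    ti = toℕ-fromℕ< q<n
    source≡ : vlayer B (inject₁ i) ≡ vertices q
    source≡ = trans (vlayer≡vertices (inject₁ i)) (cong vertices (trans (toℕ-inject₁ i) ti))
    target≡ : vlayer B (suc i) ≡ vertices (suc q)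
    target≡ = trans (vlayer≡vertices (suc i)) (cong (λ j → vertices (suc j)) ti)
    layer≡ : Defs.trans B i ≡ layer q
    layer≡ = trans (cong proj₁ (lookup≡entry i)) (cong layer ti)

length-phase₂ : ∀ {k} L R (ls : Vec (Layer × Subset 3) k) gs xs → length (phase₂ L R ls gs xs) ≤ suc k
length-phase₂ L R []             []           []       = ≤-refl
length-phase₂ L R ((f , _) ∷ ls) (false ∷ gs) (x ∷ xs) = m≤n⇒m≤1+n (length-phase₂ _ _ ls gs xs)
length-phase₂ L R ((f , _) ∷ ls) (true ∷ gs)  (x ∷ xs) = s≤s (length-phase₂ _ _ ls gs xs)

length-phase₁ : ∀ {k} pre R (ls : Vec (Layer × Subset 3) k) gs xs → length (phase₁ pre R ls gs xs) ≤ k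
length-phase₁ pre R []             []           []       = z≤n
length-phase₁ pre R ((f , _) ∷ ls) (false ∷ gs) (x ∷ xs) = m≤n⇒m≤1+n (length-phase₁ _ _ ls gs xs)
length-phase₁ pre R ((f , _) ∷ ls) (true ∷ gs)  (x ∷ xs) = length-phase₂ _ _ ls gs xs

-- The counter counts the non-regular layers since the last layer with a non-full endpoint. The first layer
-- is not counted: it absorbs the fixed prefix of B.
counterStep : Bool → ℕ → Subset 3 → Layer → Subset 3 → ℕ
counterStep true  c W L R = 0
counterStep false c W L R = if isFull W ∧ isFull R then c + ind (not (regularLayer W L R)) else 0

CounterBounded : ℕ → Bool → ℕ → Subset 3 → List (Layer × Subset 3) → Set
CounterBounded K first c W []             = Unit
CounterBounded K first c W ((L , R) ∷ Ls) =
  counterStep first c W L R ≤ K × CounterBounded K false (counterStep first c W L R) R Ls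

module RestrictionView {n} (B : OBP n) (wf : WellFormed B) (g : Fin n → Bool) (x : Vec Bool n) where
  open ProgramView B

  free : ℕ → Bool
  free = freeAt g

  bit : ℕ → Bool
  bit = lookupOr x false

  fixedMap : ℕ → Fin 3 → Fin 3
  fixedMap q u = layer q u (bit q)

  reach : ℕ → Subset 3
  reach zero    = OBP.V₀ B
  reach (suc q) = if free q then image₂ (reach q) (layer q) else image (reach q) (fixedMap q)

  freeRun : ℕ → ℕ
  freeRun zero    = 0
  freeRun (suc q) = if isFull (reach q) ∧ isFull (reach (suc q)) then freeRun q + ind (nonRegular q ∧ free q) else 0

  reach-fixed : ∀ q → free q ≡ false → reach (suc q) ≡ image (reach q) (fixedMap q)
  reach-fixed q fixed rewrite fixed = refl

  reach-free : ∀ q → free q ≡ true → reach (suc q) ≡ image₂ (reach q) (layer q)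
  reach-free q isFree rewrite isFree = refl

  freeRun-suc : ∀ q → isFull (reach q) ≡ true → isFull (reach (suc q)) ≡ true → freeRun (suc q) ≡ freeRun q + ind (nonRegular q ∧ free q)
  freeRun-suc q full full' rewrite full | full' = refl

  reach⊆vertices : ∀ q → q ≤ n → reach q ⊆ vertices q
  reach⊆vertices zero    _   v∈ = v∈
  reach⊆vertices (suc q) q<n {v} v∈ with free q
  ... | true  with image₂-∈⁻ (reach q) (layer q) v ([]=⇒lookup v∈)
  ...   | u , u∈ , b , refl = layer-∈ wf q q<n u b (reach⊆vertices q (<⇒≤ q<n) u∈)
  reach⊆vertices (suc q) q<n {v} v∈ | false with image-∈⁻ (reach q) (fixedMap q) v ([]=⇒lookup v∈)
  ...   | u , u∈ , refl = layer-∈ wf q q<n u (bit q) (reach⊆vertices q (<⇒≤ q<n) u∈)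

  full-reach⇒vertices≡⊤ : ∀ q → q ≤ n → isFull (reach q) ≡ true → vertices q ≡ ⊤
  full-reach⇒vertices≡⊤ q q≤n full = isFull⇒≡⊤ (vertices q) (isFull-⊆ (reach q) (vertices q) (reach⊆vertices q q≤n) full)

  -- ls, gs and xs are what phase₁ and phase₂ still have to read of the layers, of g and of x at position q.
  record Aligned {k} (q : ℕ) (ls : Vec (Layer × Subset 3) k) (gs xs : Vec Bool k) : Set where
    field
      fits    : q + k ≤ n
      entries : ∀ i → lookup ls i ≡ entry (q + toℕ i)
      frees   : ∀ i → lookup gs i ≡ free (q + toℕ i)
      bits    : ∀ i → lookup xs i ≡ bit (q + toℕ i)

  module _ {k q f S b y} {ls : Vec (Layer × Subset 3) k} {gs xs : Vec Bool k}
           (al : Aligned q ((f , S) ∷ ls) (b ∷ gs) (y ∷ xs)) where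
    open Aligned al

    aligned-tail : Aligned (suc q) ls gs xs
    aligned-tail = record
      { fits    = subst (_≤ n) (+-suc q k) fits
      ; entries = λ i → trans (entries (suc i)) (cong entry (+-suc q (toℕ i)))
      ; frees   = λ i → trans (frees (suc i)) (cong free (+-suc q (toℕ i)))
      ; bits    = λ i → trans (bits (suc i)) (cong bit (+-suc q (toℕ i)))
      }

    aligned-layer : f ≡ layer q
    aligned-layer = cong proj₁ (trans (entries zero) (cong entry (+-identityʳ q)))

    aligned-free : b ≡ free q
    aligned-free = trans (frees zero) (cong free (+-identityʳ q))

    aligned-bit : y ≡ bit q
    aligned-bit = trans (bits zero) (cong bit (+-identityʳ q))

    aligned-< : q < n
    aligned-< = ≤-trans (s≤s (m≤m+n q k)) (subst (_≤ n) (+-suc q k) fits)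

  -- The restricted layer L under construction was started by the free layer p and now ends at vertex layer q.
  record Invariant (first : Bool) (c : ℕ) (W : Subset 3) (L : Layer) (p q : ℕ) : Set where
    field
      whenFull : first ≡ false → isFull W ≡ true → isFull (reach q) ≡ true →
        c + ind (nonRegular p) ≤ freeRun q × (nonRegular p ≡ true ⊎ (∀ v → inDegree L v ≡ 2))
  open Invariant

  counterStep≤freeRun : ∀ first c W L p q → Invariant first c W L p q → counterStep first c W L (reach q) ≤ freeRun q
  counterStep≤freeRun true  c W L p q inv = z≤n
  counterStep≤freeRun false c W L p q inv with isFull W in fullW | isFull (reach q) in fullR
  ... | false | _     = z≤n
  ... | true  | false = z≤n
  ... | true  | true  with whenFull inv refl fullW fullR
  ...   | bound , regular = ≤-trans (+-monoʳ-≤ c (emitted regular)) bound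
    where
    emitted : nonRegular p ≡ true ⊎ (∀ v → inDegree L v ≡ 2) → ind (not (regularLayer W L (reach q))) ≤ ind (nonRegular p)
    emitted (inj₁ nonReg) rewrite nonReg = ind≤1 _
    emitted (inj₂ in2) rewrite isFull⇒≡⊤ W fullW | isFull⇒≡⊤ (reach q) fullR | inDegree≡2⇒regular⊤ L in2 = z≤n

  -- On a run of full reachable sets a fixed layer is a permutation, which preserves in-degrees.
  invariant-fixed : ∀ {first c W L p} q → free q ≡ false → Invariant first c W L p q
    → Invariant first c W (λ u b → fixedMap q (L u b)) p (suc q)
  invariant-fixed {L = L} q fixed inv .whenFull notFirst fullW full' =
      ≤-trans (proj₁ previous) (≤-trans (m≤m+n _ _) (≤-reflexive (sym (freeRun-suc q full full'))))
    , map₂ (λ in2 v → trans (inDegree-∘onto (fixedMap q) L onto v) (in2 _)) (proj₂ previous)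
    where
    fullImage : isFull (image (reach q) (fixedMap q)) ≡ true
    fullImage = subst (λ R → isFull R ≡ true) (reach-fixed q fixed) full'
    full : isFull (reach q) ≡ true
    full = isFull-image⇒isFull (reach q) (fixedMap q) fullImage
    onto : Onto (fixedMap q)
    onto = subst (λ R → isFull (image R (fixedMap q)) ≡ true) (isFull⇒≡⊤ (reach q) full) fullImage
    previous = whenFull inv notFirst fullW full

  invariant-free : ∀ {first c W L p} q → q < n → free q ≡ true → Invariant first c W L p q
    → Invariant false (counterStep first c W L (reach q)) (reach q) (layer q) q (suc q)
  invariant-free {first} {c} {W} {L} {p} q q<n isFree inv .whenFull _ full full' = bound , regular (nonRegular q) refl
    where
    freeNonRegular≡ : nonRegular q ∧ free q ≡ nonRegular q
    freeNonRegular≡ = trans (cong (nonRegular q ∧_) isFree) (∧-identityʳ (nonRegular q))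
    bound : counterStep first c W L (reach q) + ind (nonRegular q) ≤ freeRun (suc q)
    bound = ≤-trans (+-monoˡ-≤ _ (counterStep≤freeRun first c W L p q inv))
                    (≤-reflexive (sym (trans (freeRun-suc q full full') (cong (λ b → freeRun q + ind b) freeNonRegular≡))))
    regular : ∀ b → nonRegular q ≡ b → nonRegular q ≡ true ⊎ (∀ v → inDegree (layer q) v ≡ 2)
    regular true  nonReg = inj₁ nonReg
    regular false reg    = inj₂ (regular⊤⇒inDegree≡2 (layer q) (subst₂ (λ S T → regularLayer S (layer q) T ≡ true)
      (full-reach⇒vertices≡⊤ q (<⇒≤ q<n) full) (full-reach⇒vertices≡⊤ (suc q) q<n full')
      (not-injective reg)))

  module Simulation (K : ℕ) (freeRun≤K : ∀ q → q ≤ n → freeRun q ≤ K) where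

    simulate₂ : ∀ {k} q (ls : Vec (Layer × Subset 3) k) gs xs → Aligned q ls gs xs
      → ∀ first c W L R p → R ≡ reach q → Invariant first c W L p q
      → CounterBounded K first c W (phase₂ L R ls gs xs)
    simulate₂ q [] [] [] al first c W L R p refl inv =
      ≤-trans (counterStep≤freeRun first c W L p q inv) (freeRun≤K q (subst (_≤ n) (+-identityʳ q) (Aligned.fits al))) , _
    simulate₂ q ((f , S) ∷ ls) (false ∷ gs) (y ∷ xs) al first c W L R p refl inv
      with aligned-layer al | aligned-bit al
    ... | refl | refl = simulate₂ (suc q) ls gs xs (aligned-tail al) first c W _ _ p (sym (reach-fixed q fixed))
                          (invariant-fixed q fixed inv)
      where
      fixed : free q ≡ false
      fixed = sym (aligned-free al)
    simulate₂ q ((f , S) ∷ ls) (true ∷ gs) (y ∷ xs) al first c W L R p refl inv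
      with aligned-layer al
    ... | refl = ≤-trans (counterStep≤freeRun first c W L p q inv) (freeRun≤K q (<⇒≤ (aligned-< al)))
               , simulate₂ (suc q) ls gs xs (aligned-tail al) false _ _ _ _ q (sym (reach-free q isFree))
                   (invariant-free q (aligned-< al) isFree inv)
      where
      isFree : free q ≡ true
      isFree = sym (aligned-free al)

    simulate₁ : ∀ {k} q (ls : Vec (Layer × Subset 3) k) gs xs → Aligned q ls gs xs
      → ∀ pre R → R ≡ reach q → CounterBounded K true 0 (OBP.V₀ B) (phase₁ pre R ls gs xs)
    simulate₁ q [] [] [] al pre R R≡ = _
    simulate₁ q ((f , S) ∷ ls) (false ∷ gs) (y ∷ xs) al pre R refl
      with aligned-layer al | aligned-bit al
    ... | refl | refl = simulate₁ (suc q) ls gs xs (aligned-tail al) _ _ (sym (reach-fixed q (sym (aligned-free al))))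
    simulate₁ q ((f , S) ∷ ls) (true ∷ gs) (y ∷ xs) al pre R refl
      with aligned-layer al
    ... | refl = simulate₂ (suc q) ls gs xs (aligned-tail al) true 0 (OBP.V₀ B) _ _ q
                   (sym (reach-free q (sym (aligned-free al)))) (record { whenFull = λ () })

    counterBounded : CounterBounded K true 0 (OBP.V₀ B) (restrictLayers B g x)
    counterBounded = simulate₁ 0 (OBP.layers B) (tabulate g) x aligned (λ u → u) (OBP.V₀ B) refl
      where
      aligned : Aligned 0 (OBP.layers B) (tabulate g) x
      aligned = record { fits = ≤-refl ; entries = lookup≡entry ; frees = lookup≡lookupOr (tabulate g) false
                       ; bits = lookup≡lookupOr x false }

-- A splitting of [0, N] at positions where `wide` fails; only positions 0 < y < N are inspected.
record Cutting (N : ℕ) (wide : ℕ → Bool) : Set where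
  field
    r         : ℕ
    1≤r       : 1 ≤ r
    r≤N⊔1     : r ≤ N ⊔ 1
    cut       : ℕ → ℕ
    cut-first : cut 0 ≡ 0
    cut-last  : cut r ≡ N
    cut≤N     : ∀ j → cut j ≤ N
    cut-mono  : ∀ j → cut j ≤ cut (suc j)
    boundary  : ∀ j → 0 < j → j < r → wide (cut j) ≡ false
    interior  : ∀ j → j < r → ∀ y → cut j < y → y < cut (suc j) → wide y ≡ true

module _ (N : ℕ) (wide : ℕ → Bool) where

  private
    narrow : ℕ → Bool
    narrow y = does (y <? N) ∧ not (wide y)

    narrow⇒< : ∀ {y} → narrow y ≡ true → y < N
    narrow⇒< {y} nar = witness (y <? N) (proj₁ (∧-true⁻ nar))

    narrow⇒¬wide : ∀ {y} → narrow y ≡ true → wide y ≡ false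
    narrow⇒¬wide {y} nar = not-injective (proj₂ (∧-true⁻ {does (y <? N)} nar))

    ¬narrow⇒wide : ∀ {y} → y < N → narrow y ≡ false → wide y ≡ true
    ¬narrow⇒wide {y} y<N nar rewrite dec-true (y <? N) y<N = not-injective nar

    firstFrom : ℕ → ℕ → ℕ
    firstFrom j zero    = N
    firstFrom j (suc f) = if narrow j then j else firstFrom (suc j) f

    firstFrom-found : ∀ j f → firstFrom j f ≡ N ⊎ (j ≤ firstFrom j f × narrow (firstFrom j f) ≡ true)
    firstFrom-found j zero    = inj₁ refl
    firstFrom-found j (suc f) with narrow j in nar
    ... | true  = inj₂ (≤-refl , nar)
    ... | false with firstFrom-found (suc j) f
    ...   | inj₁ ≡N           = inj₁ ≡N
    ...   | inj₂ (j< , found) = inj₂ (<⇒≤ j< , found)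

    firstFrom-before : ∀ j f → N ≤ j + f → ∀ y → j ≤ y → y < firstFrom j f → narrow y ≡ false
    firstFrom-before j zero    N≤ y j≤y y<N = ⊥-elim (<⇒≱ y<N (≤-trans (subst (N ≤_) (+-identityʳ j) N≤) j≤y))
    firstFrom-before j (suc f) N≤ y j≤y y< with narrow j in nar
    ... | true  = ⊥-elim (<⇒≱ y< j≤y)
    ... | false with m≤n⇒m<n∨m≡n j≤y
    ...   | inj₁ j<y  = firstFrom-before (suc j) f (subst (N ≤_) (+-suc j f) N≤) y j<y y<
    ...   | inj₂ refl = nar

    first : ℕ
    first = firstFrom 1 N

    first≤N : first ≤ N
    first≤N with firstFrom-found 1 N
    ... | inj₁ ≡N         = ≤-reflexive ≡N
    ... | inj₂ (_ , found) = <⇒≤ (narrow⇒< found)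

    before-first : ∀ y → 1 ≤ y → y < first → narrow y ≡ false
    before-first = firstFrom-before 1 N (n≤1+n N)

    first<N⇒narrow : first < N → narrow first ≡ true
    first<N⇒narrow first<N with firstFrom-found 1 N
    ... | inj₁ ≡N         = ⊥-elim (<-irrefl ≡N first<N)
    ... | inj₂ (_ , found) = found

    1≤first : 1 ≤ N → 1 ≤ first
    1≤first 1≤N with firstFrom-found 1 N
    ... | inj₁ ≡N          = subst (1 ≤_) (sym ≡N) 1≤N
    ... | inj₂ (1≤ , _)    = 1≤

    lastUpTo : ℕ → ℕ
    lastUpTo zero    = 0
    lastUpTo (suc j) = if narrow (suc j) then suc j else lastUpTo j

    lastUpTo≤ : ∀ j → lastUpTo j ≤ j
    lastUpTo≤ zero    = z≤n
    lastUpTo≤ (suc j) with narrow (suc j)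
    ... | true  = ≤-refl
    ... | false = m≤n⇒m≤1+n (lastUpTo≤ j)

    lastUpTo-found : ∀ j → lastUpTo j ≡ 0 ⊎ narrow (lastUpTo j) ≡ true
    lastUpTo-found zero    = inj₁ refl
    lastUpTo-found (suc j) with narrow (suc j) in nar
    ... | true  = inj₂ nar
    ... | false = lastUpTo-found j

    after-lastUpTo : ∀ j y → lastUpTo j < y → y ≤ j → narrow y ≡ false
    after-lastUpTo zero    y last<y y≤0 = ⊥-elim (<⇒≱ last<y y≤0)
    after-lastUpTo (suc j) y last<y y≤ with narrow (suc j) in nar
    ... | true  = ⊥-elim (<⇒≱ last<y y≤)
    ... | false with m≤n⇒m<n∨m≡n y≤
    ...   | inj₁ y<  = after-lastUpTo j y last<y (≤-pred y<)
    ...   | inj₂ refl = nar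

    lastUpTo-suc : ∀ j → lastUpTo j ≤ lastUpTo (suc j)
    lastUpTo-suc j with narrow (suc j)
    ... | true  = m≤n⇒m≤1+n (lastUpTo≤ j)
    ... | false = ≤-refl

    lastUpTo-mono : ∀ i d → lastUpTo i ≤ lastUpTo (d + i)
    lastUpTo-mono i zero    = ≤-refl
    lastUpTo-mono i (suc d) = ≤-trans (lastUpTo-mono i d) (lastUpTo-suc (d + i))

    lastUpTo-narrow : ∀ j → narrow j ≡ true → 1 ≤ j → lastUpTo j ≡ j
    lastUpTo-narrow (suc j) nar _ rewrite nar = refl

    -- With `first` the first narrow position (or N), boundary j > 0 is the last narrow position up to
    -- first + j − 1; repeated boundaries give empty pieces.
    r : ℕ
    r = suc (N ∸ first)

    cutAfter : ∀ j → Dec (j + first < N) → ℕ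
    cutAfter j (yes _) = lastUpTo (j + first)
    cutAfter j (no _)  = N

    cut : ℕ → ℕ
    cut zero    = 0
    cut (suc j) = cutAfter j (j + first <? N)

    inner : ∀ j → suc j < r → j + first < N
    inner j sj<r = subst (j + first <_) (m∸n+n≡m first≤N) (+-monoˡ-< first (≤-pred sj<r))

    cut-inner : ∀ j → suc j < r → cut (suc j) ≡ lastUpTo (j + first)
    cut-inner j sj<r with j + first <? N
    ... | yes _         = refl
    ... | no  j+first≮N = ⊥-elim (j+first≮N (inner j sj<r))

    cut-last : cut r ≡ N
    cut-last with (N ∸ first) + first <? N
    ... | yes lt = ⊥-elim (<-irrefl (m∸n+n≡m first≤N) lt)
    ... | no  _  = refl

    cut≤N : ∀ j → cut j ≤ N
    cut≤N zero    = z≤n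
    cut≤N (suc j) with j + first <? N
    ... | yes j+first<N = ≤-trans (lastUpTo≤ (j + first)) (<⇒≤ j+first<N)
    ... | no  _         = ≤-refl

    cut-mono : ∀ j → cut j ≤ cut (suc j)
    cut-mono zero    = z≤n
    cut-mono (suc j) with j + first <? N | suc j + first <? N
    ... | yes _ | yes _       = lastUpTo-suc (j + first)
    ... | yes j+first<N | no _ = ≤-trans (lastUpTo≤ (j + first)) (<⇒≤ j+first<N)
    ... | no  _ | no _         = ≤-refl
    ... | no  j+first≮N | yes sj+first<N = ⊥-elim (j+first≮N (<-trans (n<1+n _) sj+first<N))

    cut1≡first : cut 1 ≡ first
    cut1≡first with first <? N
    ... | yes first<N = lastUpTo-narrow first (first<N⇒narrow first<N) (1≤first (≤-trans (s≤s z≤n) first<N))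
    ... | no  first≮N = ≤-antisym (≮⇒≥ first≮N) first≤N

    boundary-narrow : ∀ j → 0 < j → j < r → narrow (cut j) ≡ true
    boundary-narrow (suc j) _ sj<r with lastUpTo-found (j + first)
    ... | inj₂ nar = subst (λ c → narrow c ≡ true) (sym (cut-inner j sj<r)) nar
    ... | inj₁ ≡0  = ⊥-elim (<⇒≱ (1≤first (≤-trans (s≤s z≤n) first<N)) (≤-trans first≤last (≤-reflexive ≡0)))
      where
      first<N : first < N
      first<N = ≤-<-trans (m≤n+m first j) (inner j sj<r)
      first≤last : first ≤ lastUpTo (j + first)
      first≤last = subst (_≤ lastUpTo (j + first))
        (lastUpTo-narrow first (first<N⇒narrow first<N) (1≤first (≤-trans (s≤s z≤n) first<N))) (lastUpTo-mono first j)

    interior-narrow : ∀ j → j < r → ∀ y → cut j < y → y < cut (suc j) → narrow y ≡ false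
    interior-narrow zero    _    y 0<y y<  = before-first y 0<y (subst (y <_) cut1≡first y<)
    interior-narrow (suc j) sj<r y last<y y< =
      after-lastUpTo (j + first) y (subst (_< y) (cut-inner j sj<r) last<y) (≤-pred (≤-trans y< cut≤next))
      where
      cut≤next : cut (suc (suc j)) ≤ suc (j + first)
      cut≤next with suc j + first <? N
      ... | yes _ = lastUpTo≤ (suc (j + first))
      ... | no  sj+first≮N = ≤-reflexive (≤-antisym (≮⇒≥ sj+first≮N) (inner j sj<r))

  cutAtNarrow : Cutting N wide
  cutAtNarrow = record
    { r = r ; 1≤r = s≤s z≤n ; r≤N⊔1 = r≤ ; cut = cut ; cut-first = refl ; cut-last = cut-last ; cut≤N = cut≤N
    ; cut-mono = cut-mono
    ; boundary = λ j 0<j j<r → narrow⇒¬wide (boundary-narrow j 0<j j<r)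
    ; interior = λ j j<r y c<y y<c → ¬narrow⇒wide (<-≤-trans y<c (cut≤N (suc j))) (interior-narrow j j<r y c<y y<c)
    }
    where
    suc∸≤⊔1 : ∀ M f → (1 ≤ M → 1 ≤ f) → suc (M ∸ f) ≤ M ⊔ 1
    suc∸≤⊔1 zero     f       _   = s≤s (≤-reflexive (0∸n≡0 f))
    suc∸≤⊔1 (suc M') zero    pos = ⊥-elim (<-irrefl refl (pos (s≤s z≤n)))
    suc∸≤⊔1 (suc M') (suc f) _   = s≤s (≤-trans (m∸n≤m M' f) (m≤m⊔n M' 0))
    r≤ : r ≤ N ⊔ 1
    r≤ = suc∸≤⊔1 N first 1≤first

fromLayers : (W : Subset 3) (Ls : List (Layer × Subset 3)) → OBP (length Ls)
fromLayers W Ls = mkOBP W (fromList Ls)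

vertexAt : Subset 3 → List (Layer × Subset 3) → ℕ → Subset 3
vertexAt W Ls = ProgramView.vertices (fromLayers W Ls)

nonRegularAt : Subset 3 → List (Layer × Subset 3) → ℕ → Bool
nonRegularAt W Ls = ProgramView.nonRegular (fromLayers W Ls)

vertexAt-∷ : ∀ W L R Ls j → vertexAt W ((L , R) ∷ Ls) (suc j) ≡ vertexAt R Ls j
vertexAt-∷ W L R Ls zero    = refl
vertexAt-∷ W L R Ls (suc j) = refl

nonRegularAt-∷ : ∀ W L R Ls j → nonRegularAt W ((L , R) ∷ Ls) (suc j) ≡ nonRegularAt R Ls j
nonRegularAt-∷ W L R Ls zero    = refl
nonRegularAt-∷ W L R Ls (suc j) = refl

vertexAt-drop : ∀ W Ls i j → i ≤ length Ls → vertexAt W Ls (i + j) ≡ vertexAt (vertexAt W Ls i) (drop i Ls) j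
vertexAt-drop W Ls             zero    j _         = refl
vertexAt-drop W ((L , R) ∷ Ls) (suc i) j (s≤s i≤) =
  trans (vertexAt-∷ W L R Ls (i + j))
        (trans (vertexAt-drop R Ls i j i≤) (cong (λ V → vertexAt V (drop i Ls) j) (sym (vertexAt-∷ W L R Ls i))))

countRange-drop : ∀ W Ls i d → i ≤ length Ls
  → countRange (nonRegularAt W Ls) i d ≡ countRange (nonRegularAt (vertexAt W Ls i) (drop i Ls)) 0 d
countRange-drop W Ls             zero    d _         = refl
countRange-drop W ((L , R) ∷ Ls) (suc i) d (s≤s i≤) = begin
  countRange (nonRegularAt W ((L , R) ∷ Ls)) (1 + i) d            ≡⟨ sumRange-shift _ 1 i d ⟩
  countRange (λ j → nonRegularAt W ((L , R) ∷ Ls) (suc j)) i d     ≡⟨ sumRange-cong i d (λ j _ → cong ind (nonRegularAt-∷ W L R Ls j)) ⟩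
  countRange (nonRegularAt R Ls) i d                               ≡⟨ countRange-drop R Ls i d i≤ ⟩
  countRange (nonRegularAt (vertexAt R Ls i) (drop i Ls)) 0 d      ≡⟨ cong (λ V → countRange (nonRegularAt V (drop i Ls)) 0 d) (sym (vertexAt-∷ W L R Ls i)) ⟩
  countRange (nonRegularAt (vertexAt W ((L , R) ∷ Ls) (suc i)) (drop i Ls)) 0 d ∎
  where open ≡-Reasoning

module _ (K : ℕ) where

  full-stretch-from : ∀ c W Ls → CounterBounded K false c W Ls → c ≤ K → ∀ d → d ≤ length Ls
    → (∀ j → j ≤ d → isFull (vertexAt W Ls j) ≡ true) → c + countRange (nonRegularAt W Ls) 0 d ≤ K
  full-stretch-from c W Ls             _               c≤K zero    _        _    = ≤-trans (≤-reflexive (+-identityʳ c)) c≤K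
  full-stretch-from c W ((L , R) ∷ Ls) (step≤K , rest) c≤K (suc d) (s≤s d≤) full = begin
    c + countRange (nonRegularAt W ((L , R) ∷ Ls)) 0 (suc d)
      ≡⟨ sym (+-assoc c _ _) ⟩
    c + ind (not (regularLayer W L R)) + countRange (nonRegularAt W ((L , R) ∷ Ls)) 1 d
      ≡⟨ cong₂ _+_ (sym step≡) (countRange-drop W ((L , R) ∷ Ls) 1 d (s≤s z≤n)) ⟩
    counterStep false c W L R + countRange (nonRegularAt R Ls) 0 d
      ≤⟨ full-stretch-from _ R Ls rest step≤K d d≤ (λ j j≤d → trans (cong isFull (sym (vertexAt-∷ W L R Ls j))) (full (suc j) (s≤s j≤d))) ⟩
    K ∎
    where
    open ≤-Reasoning
    step≡ : counterStep false c W L R ≡ c + ind (not (regularLayer W L R))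
    step≡ rewrite full 0 z≤n | full 1 (s≤s z≤n) = refl

  CounterBounded-drop : ∀ first c W Ls → CounterBounded K first c W Ls → ∀ i → 1 ≤ i → i ≤ length Ls →
    Σ[ c' ∈ ℕ ] c' ≤ K × CounterBounded K false c' (vertexAt W Ls i) (drop i Ls)
  CounterBounded-drop first c W ((L , R) ∷ Ls) (step≤K , rest) (suc zero)    _ _         = _ , step≤K , rest
  CounterBounded-drop first c W ((L , R) ∷ Ls) (step≤K , rest) (suc (suc i)) _ (s≤s i<) =
    CounterBounded-drop false _ R Ls rest (suc i) (s≤s z≤n) i<

  module _ (W : Subset 3) (Ls : List (Layer × Subset 3)) (bounded : CounterBounded K true 0 W Ls) where

    private
      N : ℕ
      N = length Ls

    full-stretch : ∀ i d → 1 ≤ i → i + d ≤ N → (∀ j → j ≤ d → isFull (vertexAt W Ls (i + j)) ≡ true)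
      → countRange (nonRegularAt W Ls) i d ≤ K
    full-stretch i d 1≤i i+d≤N full with CounterBounded-drop true 0 W Ls bounded i 1≤i (m+n≤o⇒m≤o i i+d≤N)
    ... | c , c≤K , rest = begin
      countRange (nonRegularAt W Ls) i d                             ≡⟨ countRange-drop W Ls i d i≤N ⟩
      countRange (nonRegularAt (vertexAt W Ls i) (drop i Ls)) 0 d     ≤⟨ m≤n+m _ c ⟩
      c + countRange (nonRegularAt (vertexAt W Ls i) (drop i Ls)) 0 d ≤⟨ full-stretch-from c _ (drop i Ls) rest c≤K d d≤ full' ⟩
      K ∎
      where
      open ≤-Reasoning
      i≤N = m+n≤o⇒m≤o i i+d≤N
      d≤ : d ≤ length (drop i Ls)
      d≤ = subst (d ≤_) (sym (length-drop i Ls)) (m+n≤o⇒m≤o∸n d (subst (_≤ N) (+-comm i d) i+d≤N))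
      full' : ∀ j → j ≤ d → isFull (vertexAt (vertexAt W Ls i) (drop i Ls) j) ≡ true
      full' j j≤d = trans (cong isFull (sym (vertexAt-drop W Ls i j i≤N))) (full j j≤d)

    -- Only the first and the last layer of a piece may touch a narrow vertex layer.
    piece-bound : ∀ a b → a ≤ b → b ≤ N → (∀ y → a < y → y < b → isFull (vertexAt W Ls y) ≡ true)
      → countRange (nonRegularAt W Ls) a (b ∸ a) ≤ K + 2
    piece-bound a b a≤b b≤N full with b ∸ a in b∸a
    ... | zero          = z≤n
    ... | suc zero      = ≤-trans (countRange≤ (nonRegularAt W Ls) a 1) (≤-trans (m≤n+m 1 (K + 1)) (≤-reflexive (+-assoc K 1 1)))
    ... | suc (suc d)   = begin
      ind (nr a) + countRange nr (suc a) (suc d)                  ≡⟨ cong (ind (nr a) +_) (sumRange-suc _ (suc a) d) ⟩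
      ind (nr a) + (countRange nr (suc a) d + ind (nr (suc a + d))) ≤⟨ +-mono-≤ (ind≤1 (nr a)) (+-mono-≤ middle (ind≤1 (nr (suc a + d)))) ⟩
      1 + (K + 1)                                                 ≡⟨ trans (+-comm 1 (K + 1)) (+-assoc K 1 1) ⟩
      K + 2 ∎
      where
      open ≤-Reasoning
      nr = nonRegularAt W Ls
      b≡ : b ≡ suc a + suc d
      b≡ = trans (sym (m+[n∸m]≡n a≤b)) (trans (cong (a +_) b∸a) (+-suc a (suc d)))
      middle : countRange nr (suc a) d ≤ K
      middle = full-stretch (suc a) d (s≤s z≤n) (≤-trans (+-monoʳ-≤ (suc a) (n≤1+n d)) (subst (_≤ N) b≡ b≤N))
        (λ j j≤d → full (suc a + j) (s≤s (m≤m+n a j)) (subst (suc a + j <_) (sym b≡) (+-monoʳ-< (suc a) (s≤s j≤d))))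

    splits : ∀ n bound → N ≤ n → 1 ≤ n → K + 2 ≤ bound → Splits n bound (fromLayers W Ls)
    splits n bound N≤n 1≤n K+2≤bound = record
      { r              = r
      ; r≥1            = 1≤r
      ; r≤n            = ≤-trans r≤N⊔1 (⊔-lub N≤n 1≤n)
      ; cuts           = cuts
      ; cuts-first     = toℕ-injective (trans (toℕ-cuts zero) cut-first)
      ; cuts-last      = toℕ-injective (trans (toℕ-cuts (fromℕ r)) (trans (cong cut (toℕ-fromℕ r)) (trans cut-last (sym (toℕ-fromℕ N)))))
      ; cuts-mono      = λ j → subst₂ _≤_ (sym (toℕ-cuts-inject₁ j)) (sym (toℕ-cuts (suc j))) (cut-mono (toℕ j))
      ; pieces-nonreg  = λ j → subst₂ (λ a b → nonRegularBetween (fromLayers W Ls) a b ≤ bound)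
                                 (sym (toℕ-cuts-inject₁ j)) (sym (toℕ-cuts (suc j))) (≤-trans (piece (toℕ j) (toℕ<n j)) K+2≤bound)
      ; boundary-width = λ j 0<j j<r →
          subst (_≤ 2) (sym (trans (cong ∣_∣ (vlayer≡vertices (cuts j))) (cong (λ y → ∣ vertexAt W Ls y ∣) (toℕ-cuts j))))
                                 (¬isFull⇒∣∣≤2 (vertexAt W Ls (cut (toℕ j))) (boundary (toℕ j) 0<j j<r))
      }
      where
      open Cutting (cutAtNarrow N (λ y → isFull (vertexAt W Ls y)))
      open ProgramView (fromLayers W Ls) using (vlayer≡vertices; nonRegularBetween≡countRange)
      cuts : Fin (suc r) → Fin (suc N)
      cuts j = fromℕ< (s≤s (cut≤N (toℕ j)))
      toℕ-cuts : ∀ j → toℕ (cuts j) ≡ cut (toℕ j)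
      toℕ-cuts j = toℕ-fromℕ< _
      toℕ-cuts-inject₁ : ∀ (j : Fin r) → toℕ (cuts (inject₁ j)) ≡ cut (toℕ j)
      toℕ-cuts-inject₁ j = trans (toℕ-cuts (inject₁ j)) (cong cut (toℕ-inject₁ j))
      piece : ∀ j → j < r → nonRegularBetween (fromLayers W Ls) (cut j) (cut (suc j)) ≤ K + 2
      piece j j<r = subst (_≤ K + 2) (sym (nonRegularBetween≡countRange _ _ (cut-mono j) (cut≤N (suc j))))
                      (piece-bound _ _ (cut-mono j) (cut≤N (suc j)) (interior j j<r))

periodic⇒window-const : ∀ (φ : ℕ → Bool) p → (∀ r → φ (r + p) ≡ φ r) → ∀ r → countRange φ r p ≡ countRange φ 0 p
periodic⇒window-const φ zero     per r       = refl
periodic⇒window-const φ (suc p') per zero    = refl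
periodic⇒window-const φ (suc p') per (suc r) = begin
  countRange φ (suc r) (suc p')              ≡⟨ sumRange-suc _ (suc r) p' ⟩
  countRange φ (suc r) p' + ind (φ (suc r + p')) ≡⟨ cong (λ c → countRange φ (suc r) p' + ind (φ c)) (sym (+-suc r p')) ⟩
  countRange φ (suc r) p' + ind (φ (r + suc p')) ≡⟨ cong (λ b → countRange φ (suc r) p' + ind b) (per r) ⟩
  countRange φ (suc r) p' + ind (φ r)        ≡⟨ +-comm _ (ind (φ r)) ⟩
  countRange φ r (suc p')                    ≡⟨ periodic⇒window-const φ (suc p') per r ⟩
  countRange φ 0 (suc p') ∎
  where open ≡-Reasoning

module Balanced (φ : ℕ → Bool) (p k : ℕ) .{{_ : NonZero p}} (window : ∀ r → countRange φ r p ≡ k) where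

  private
    ψ : ℕ → Bool
    ψ c = not (φ c)

  countRange-periods : ∀ q r → countRange φ r (q * p) ≡ q * k
  countRange-periods zero    r = refl
  countRange-periods (suc q) r =
    trans (sumRange-+ _ r p (q * p)) (cong₂ _+_ (window r) (countRange-periods q (r + p)))

  countRange-not-periods : ∀ q r → countRange ψ r (q * p) ≡ q * (p ∸ k)
  countRange-not-periods q r = begin
    countRange ψ r (q * p)                                   ≡⟨ sym (m+n∸m≡n (countRange φ r (q * p)) _) ⟩
    countRange φ r (q * p) + countRange ψ r (q * p) ∸ countRange φ r (q * p)
                                                             ≡⟨ cong₂ _∸_ (countRange-+-not φ r (q * p)) (countRange-periods q r) ⟩
    q * p ∸ q * k                                            ≡⟨ sym (*-distribˡ-∸ q p k) ⟩
    q * (p ∸ k) ∎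
    where open ≡-Reasoning

  -- Write D = e + q p with e < p: the φ-count is at most (q + 1) k, the ψ-count at least q (p − k).
  balanced : ∀ r D → countRange φ r D * (p ∸ k) ≤ k * (countRange ψ r D + (p ∸ k))
  balanced r D = begin
    countRange φ r D * M                         ≤⟨ *-monoˡ-≤ M φ-bound ⟩
    (k + q * k) * M                              ≡⟨ rearrange k q M ⟩
    k * (q * M + M)                              ≤⟨ *-monoʳ-≤ k (+-monoˡ-≤ M ψ-bound) ⟩
    k * (countRange ψ r D + M) ∎
    where
    open ≤-Reasoning
    M = p ∸ k
    e = D % p
    q = D / p
    D≡ : D ≡ e + q * p
    D≡ = m≡m%n+[m/n]*n D p
    φ-bound : countRange φ r D ≤ k + q * k
    φ-bound = begin
      countRange φ r D                                        ≡⟨ cong (countRange φ r) D≡ ⟩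
      countRange φ r (e + q * p)                              ≡⟨ sumRange-+ _ r e (q * p) ⟩
      countRange φ r e + countRange φ (r + e) (q * p)         ≤⟨ +-mono-≤ (countRange-monoʳ φ r (<⇒≤ (m%n<n D p))) (≤-reflexive (countRange-periods q (r + e))) ⟩
      countRange φ r p + q * k                                ≡⟨ cong (_+ q * k) (window r) ⟩
      k + q * k ∎
    ψ-bound : q * M ≤ countRange ψ r D
    ψ-bound = begin
      q * M                                                   ≡⟨ sym (countRange-not-periods q (r + e)) ⟩
      countRange ψ (r + e) (q * p)                            ≤⟨ m≤n+m _ _ ⟩
      countRange ψ r e + countRange ψ (r + e) (q * p)         ≡⟨ sym (sumRange-+ _ r e (q * p)) ⟩
      countRange ψ r (e + q * p)                              ≡⟨ cong (countRange ψ r) (sym D≡) ⟩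
      countRange ψ r D ∎
    rearrange : ∀ k q M → (k + q * k) * M ≡ k * (q * M + M)
    rearrange = solve-∀

freeChunk : ∀ {m} → Subset (suc m) → ℕ → Bool
freeChunk {m} t c = lookup t (suc c mod suc m)

∣∣≡countFin : ∀ {k} (t : Subset k) → ∣ t ∣ ≡ countFin (lookup t)
∣∣≡countFin []            = refl
∣∣≡countFin (true ∷ t)  = cong suc (∣∣≡countFin t)
∣∣≡countFin (false ∷ t) = ∣∣≡countFin t

module _ {m : ℕ} (t : Subset (suc m)) where

  private
    mod-cong : ∀ a b → a % suc m ≡ b % suc m → a mod suc m ≡ b mod suc m
    mod-cong a b eq = fromℕ<-cong _ _ eq (m%n<n a (suc m)) (m%n<n b (suc m))

    freeChunk-periodic : ∀ r → freeChunk t (r + suc m) ≡ freeChunk t r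
    freeChunk-periodic r = cong (lookup t) (mod-cong (suc (r + suc m)) (suc r) ([m+n]%n≡m%n (suc r) (suc m)))

    last-window : countRange (freeChunk t) m (suc m) ≡ ∣ t ∣
    last-window = begin
      countRange (freeChunk t) m (suc m)                          ≡⟨ cong (λ a → countRange (freeChunk t) a (suc m)) (sym (+-identityʳ m)) ⟩
      countRange (freeChunk t) (m + 0) (suc m)                    ≡⟨ sumRange-shift _ m 0 (suc m) ⟩
      countRange (λ j → freeChunk t (m + j)) 0 (suc m)            ≡⟨ sumRange-cong 0 (suc m) (λ j r → cong ind (cong (lookup t) (shifted j (proj₂ r)))) ⟩
      countRange (λ j → lookup t (j mod suc m)) 0 (suc m)         ≡⟨ sym (countFin≡countRange (lookup t) _ 0 (λ i → cong (lookup t) (sym (reduced i)))) ⟩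
      countFin (lookup t)                                         ≡⟨ sym (∣∣≡countFin t) ⟩
      ∣ t ∣ ∎
      where
      open ≡-Reasoning
      shifted : ∀ j → j < suc m → suc (m + j) mod suc m ≡ j mod suc m
      shifted j _ = mod-cong (suc (m + j)) j (trans (cong (_% suc m) (trans (sym (+-suc m j)) (+-comm m (suc j))))
                                    (trans (cong (_% suc m) (sym (+-suc j m))) ([m+n]%n≡m%n j (suc m))))
      reduced : ∀ (i : Fin (suc m)) → toℕ i mod suc m ≡ i
      reduced i = trans (fromℕ<-cong _ _ (m<n⇒m%n≡m (toℕ<n i)) (m%n<n (toℕ i) (suc m)) (toℕ<n i)) (fromℕ<-toℕ i (toℕ<n i))

  freeChunk-window : ∀ r → countRange (freeChunk t) r (suc m) ≡ ∣ t ∣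
  freeChunk-window r = begin
    countRange (freeChunk t) r (suc m)          ≡⟨ window-const r ⟩
    countRange (freeChunk t) 0 (suc m)          ≡⟨ sym (window-const m) ⟩
    countRange (freeChunk t) m (suc m)          ≡⟨ last-window ⟩
    ∣ t ∣ ∎
    where
    open ≡-Reasoning
    window-const = periodic⇒window-const (freeChunk t) (suc m) freeChunk-periodic

rank : (ℕ → Bool) → ℕ → ℕ
rank marked q = countRange marked 0 q

rank-suc : ∀ marked q → rank marked (suc q) ≡ rank marked q + ind (marked q)
rank-suc marked q = sumRange-suc _ 0 q

countRange-∧-rank : ∀ (marked G F : ℕ → Bool) n → (∀ q → q < n → marked q ≡ true → G q ≡ F (rank marked q))
  → ∀ a d → a + d ≤ n → countRange (λ j → marked j ∧ G j) a d ≡ countRange F (rank marked a) (countRange marked a d)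
countRange-∧-rank marked G F n G≡F a zero    _     = refl
countRange-∧-rank marked G F n G≡F a (suc d) a+d<n = begin
  ind (marked a ∧ G a) + countRange (λ j → marked j ∧ G j) (suc a) d
    ≡⟨ cong₂ _+_ (first (marked a) refl) (countRange-∧-rank marked G F n G≡F (suc a) d (subst (_≤ n) (+-suc a d) a+d<n)) ⟩
  countRange F r (ind (marked a)) + countRange F (rank marked (suc a)) (countRange marked (suc a) d)
    ≡⟨ cong (λ r' → countRange F r (ind (marked a)) + countRange F r' (countRange marked (suc a) d)) (rank-suc marked a) ⟩
  countRange F r (ind (marked a)) + countRange F (r + ind (marked a)) (countRange marked (suc a) d)
    ≡⟨ sym (sumRange-+ _ r (ind (marked a)) _) ⟩
  countRange F r (countRange marked a (suc d)) ∎
  where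
  open ≡-Reasoning
  r = rank marked a
  first : ∀ b → marked a ≡ b → ind (marked a ∧ G a) ≡ countRange F r (ind b)
  first false ma rewrite ma = refl
  first true  ma rewrite ma | G≡F a (≤-trans (s≤s (m≤m+n a d)) (subst (_≤ n) (+-suc a d) a+d<n)) ma = sym (+-identityʳ _)

module ChunkRank (n l : ℕ) (marked : ℕ → Bool) (chunk : ℕ → ℕ)
  (chunk< : ∀ q → q < n → chunk q < l)
  (chunk-mono : ∀ q q' → q ≤ q' → q' < n → chunk q ≤ chunk q')
  (marked-exists : ∀ c → c < l → Σ[ p ∈ ℕ ] p < n × chunk p ≡ c × marked p ≡ true)
  (marked-unique : ∀ p p' → p < n → p' < n → marked p ≡ true → marked p' ≡ true → chunk p ≡ chunk p' → p ≡ p')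
  where

  private
    earlier-chunk : ∀ p q → p < q → q < n → marked p ≡ true → marked q ≡ true → chunk p < chunk q
    earlier-chunk p q p<q q<n mp mq =
      ≤∧≢⇒< (chunk-mono p q (<⇒≤ p<q) q<n) (λ eq → <-irrefl (marked-unique p q (<-trans p<q q<n) q<n mp mq eq) p<q)

    before : ∀ p q → p < n → chunk p < chunk q → p < q
    before p q p<n lt with p <? q
    ... | yes p<q = p<q
    ... | no  p≮q = ⊥-elim (<⇒≱ lt (chunk-mono q p (≮⇒≥ p≮q) p<n))

  chunk≡rank : ∀ c q → q < n → marked q ≡ true → chunk q ≡ c → rank marked q ≡ c
  chunk≡rank zero q q<n mq cq = sumRange-zero 0 q λ p (_ , p<q) → unmarked p p<q
    where
    unmarked : ∀ p → p < q → ind (marked p) ≡ 0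
    unmarked p p<q with marked p in mp
    ... | false = refl
    ... | true  = ⊥-elim (<⇒≱ (earlier-chunk p q p<q q<n mp mq) (subst (_≤ chunk p) (sym cq) z≤n))
  chunk≡rank (suc c) q q<n mq cq with marked-exists c (<-trans (n<1+n c) (subst (_< l) cq (chunk< q q<n)))
  ... | p , p<n , cp , mp = begin
    rank marked q                                                ≡⟨ cong (rank marked) (sym (m+[n∸m]≡n (<⇒≤ p<q))) ⟩
    countRange marked 0 (p + (q ∸ p))                            ≡⟨ sumRange-+ _ 0 p (q ∸ p) ⟩
    rank marked p + countRange marked p (q ∸ p)                  ≡⟨ cong₂ _+_ (chunk≡rank c p p<n mp cp) gap ⟩
    c + 1                                                        ≡⟨ +-comm c 1 ⟩
    suc c ∎
    where
    open ≡-Reasoning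
    p<q : p < q
    p<q = before p q p<n (subst₂ _<_ (sym cp) (sym cq) (n<1+n c))
    between-unmarked : ∀ p' → p < p' → p' < q → ind (marked p') ≡ 0
    between-unmarked p' p<p' p'<q with marked p' in mp'
    ... | false = refl
    ... | true  = ⊥-elim (<⇒≱ (earlier-chunk p p' p<p' (<-trans p'<q q<n) mp mp')
                               (subst (chunk p' ≤_) (sym cp) (≤-pred (subst (chunk p' <_) cq (earlier-chunk p' q p'<q q<n mp' mq)))))
    gap : countRange marked p (q ∸ p) ≡ 1
    gap with q ∸ p in q∸p
    ... | zero  = ⊥-elim (<-irrefl (sym (≤-antisym (m∸n≡0⇒m≤n q∸p) (<⇒≤ p<q)) ) p<q)
    ... | suc d = cong₂ _+_ (cong ind mp) (sumRange-zero (suc p) d (λ p' (p<p' , p'<) →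
                    between-unmarked p' p<p' (subst (p' <_) (trans (sym (+-suc p d)) (trans (cong (p +_) (sym q∸p)) (m+[n∸m]≡n (<⇒≤ p<q)))) p'<)))

  marked⇒chunk≡rank : ∀ q → q < n → marked q ≡ true → chunk q ≡ rank marked q
  marked⇒chunk≡rank q q<n mq = sym (chunk≡rank (chunk q) q q<n mq refl)

module ChunkStructure {n l} (B : OBP n) (D : ChunkDecomposition B l) where
  open ProgramView B
  open ChunkDecomposition D

  chunkAt : ℕ → ℕ
  chunkAt = lookupOr (tabulate (λ i → toℕ (chunk i))) 0

  chunkAt-fromℕ< : ∀ q (q<n : q < n) → chunkAt q ≡ toℕ (chunk (fromℕ< q<n))
  chunkAt-fromℕ< q q<n = lookupOr-tabulate (λ i → toℕ (chunk i)) 0 q q<n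

  chunkAt-toℕ : ∀ i → chunkAt (toℕ i) ≡ toℕ (chunk i)
  chunkAt-toℕ i = trans (sym (lookup≡lookupOr (tabulate (λ i → toℕ (chunk i))) 0 i)) (lookup∘tabulate _ i)

  chunkAt< : ∀ q → q < n → chunkAt q < l
  chunkAt< q q<n = subst (_< l) (sym (chunkAt-fromℕ< q q<n)) (toℕ<n _)

  chunkAt-mono : ∀ q q' → q ≤ q' → q' < n → chunkAt q ≤ chunkAt q'
  chunkAt-mono q q' q≤q' q'<n = subst₂ _≤_ (sym (chunkAt-fromℕ< q q<n)) (sym (chunkAt-fromℕ< q' q'<n))
    (monotone _ _ (subst₂ _≤_ (sym (toℕ-fromℕ< q<n)) (sym (toℕ-fromℕ< q'<n)) q≤q'))
    where
    q<n = ≤-<-trans q≤q' q'<n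

  inChunk : ℕ → ℕ → Bool
  inChunk c q = does (chunkAt q ≟ c) ∧ nonRegular q

  one-nonRegular-per-chunk : ∀ c → c < l → countRange (inChunk c) 0 n ≡ 1
  one-nonRegular-per-chunk c c<l = trans (sym (countFin≡countRange _ (inChunk c) 0 same)) (oneNonRegular (fromℕ< c<l))
    where
    same : ∀ i → does (chunk i F.≟ fromℕ< c<l) ∧ not (regularᵇ B i) ≡ inChunk c (toℕ i)
    same i = cong₂ _∧_ (does-⇔ (mk⇔ (λ eq → trans (chunkAt-toℕ i) (trans (cong toℕ eq) (toℕ-fromℕ< c<l)))
                                    (λ eq → toℕ-injective (trans (sym (chunkAt-toℕ i)) (trans eq (sym (toℕ-fromℕ< c<l))))))
                                (chunk i F.≟ fromℕ< c<l) (chunkAt (toℕ i) ≟ c))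
                       (nonRegular≡ i)

  nonRegular-exists : ∀ c → c < l → Σ[ p ∈ ℕ ] p < n × chunkAt p ≡ c × nonRegular p ≡ true
  nonRegular-exists c c<l with countRange-pos (inChunk c) 0 n (≤-reflexive (sym (one-nonRegular-per-chunk c c<l)))
  ... | p , (_ , p<n) , found with ∧-true⁻ {does (chunkAt p ≟ c)} found
  ...   | inC , nonReg = p , p<n , witness (chunkAt p ≟ c) inC , nonReg

  nonRegular-unique : ∀ p p' → p < n → p' < n → nonRegular p ≡ true → nonRegular p' ≡ true → chunkAt p ≡ chunkAt p' → p ≡ p'
  nonRegular-unique p p' p<n p'<n nr nr' same =
    countRange≡1 (inChunk (chunkAt p)) 0 n (one-nonRegular-per-chunk (chunkAt p) (chunkAt< p p<n)) p p' (z≤n , p<n) (z≤n , p'<n)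
      (cong₂ _∧_ (dec-true (chunkAt p ≟ chunkAt p) refl) nr) (cong₂ _∧_ (dec-true (chunkAt p' ≟ chunkAt p) (sym same)) nr')

  open ChunkRank n l nonRegular chunkAt chunkAt< chunkAt-mono nonRegular-exists nonRegular-unique public

module FreeBalance {n l} (B : OBP n) (D : ChunkDecomposition B l) (m : ℕ) (t : Subset (suc m)) where
  open ProgramView B
  open ChunkStructure B D

  free : ℕ → Bool
  free = freeAt (gₜ D (suc m) t)

  free≡freeChunk : ∀ q → q < n → nonRegular q ≡ true → free q ≡ freeChunk t (rank nonRegular q)
  free≡freeChunk q q<n nr = begin
    free q                            ≡⟨ lookupOr-tabulate (gₜ D (suc m) t) false q q<n ⟩
    freeChunk t (toℕ (ChunkDecomposition.chunk D (fromℕ< q<n))) ≡⟨ cong (freeChunk t) (sym (chunkAt-fromℕ< q q<n)) ⟩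
    freeChunk t (chunkAt q)           ≡⟨ cong (freeChunk t) (marked⇒chunk≡rank q q<n nr) ⟩
    freeChunk t (rank nonRegular q) ∎
    where open ≡-Reasoning

  -- Consecutive non-regular layers lie in consecutive chunks, and chunks are free with period m + 1.
  free-fixed-balance : ∀ a d → a + d ≤ n
    → countRange (λ j → nonRegular j ∧ free j) a d * (suc m ∸ ∣ t ∣)
      ≤ ∣ t ∣ * (countRange (λ j → nonRegular j ∧ not (free j)) a d + (suc m ∸ ∣ t ∣))
  free-fixed-balance a d a+d≤n =
    subst₂ (λ f e → f * (suc m ∸ ∣ t ∣) ≤ ∣ t ∣ * (e + (suc m ∸ ∣ t ∣))) (sym freeCount) (sym fixedCount)
      (balanced (rank nonRegular a) (countRange nonRegular a d))
    where
    open Balanced (freeChunk t) (suc m) ∣ t ∣ (freeChunk-window t)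
    freeCount = countRange-∧-rank nonRegular free (freeChunk t) n free≡freeChunk a d a+d≤n
    fixedCount = countRange-∧-rank nonRegular (λ j → not (free j)) (λ c → not (freeChunk t c)) n
                   (λ q q<n nr → cong not (free≡freeChunk q q<n nr)) a d a+d≤n

module ExceptionalInputs {n} (B : OBP n) (g : Fin n → Bool) (s : ℕ) where
  open ProgramView B

  fixedNonRegular : ℕ → Bool
  fixedNonRegular j = nonRegular j ∧ not (freeAt g j)

  -- the first s fixed non-regular layers from position a on
  constrained : ℕ → ℕ → Bool
  constrained a q = fixedNonRegular q ∧ does (a ≤? q) ∧ does (countRange fixedNonRegular a (q ∸ a) <? s)

  permutes : ℕ → Bool → Bool
  permutes q b = isFull (vertices q) ∧ isFull (vertices (suc q)) ∧ isFull (image ⊤ (λ u → layer q u b))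

  allowed : ℕ → ℕ → Bool → Bool
  allowed a q b = not (constrained a q) ∨ permutes q b

  -- y turns each of the first s fixed non-regular layers after a into a permutation
  exceptionalAt : ℕ → Vec Bool n → Bool
  exceptionalAt a y = does (s ≤? countRange (constrained a) 0 n) ∧ admissible (allowed a) 0 y

  good : Vec Bool n → Bool
  good y = countRange (λ a → exceptionalAt a y) 0 n ≡ᵇ 0

  permutes-both⇒regular : ∀ q → permutes q true ≡ true → permutes q false ≡ true → nonRegular q ≡ false
  permutes-both⇒regular q perm₁ perm₀ with ∧-true⁻ {isFull (vertices q)} perm₁ | ∧-true⁻ {isFull (vertices q)} perm₀
  ... | full , rest₁ | _ , rest₀ with ∧-true⁻ {isFull (vertices (suc q))} rest₁ | ∧-true⁻ {isFull (vertices (suc q))} rest₀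
  ...   | full' , onto₁ | _ , onto₀ =
    cong not (trans (cong₂ (λ S T → regularLayer S (layer q) T) (isFull⇒≡⊤ (vertices q) full) (isFull⇒≡⊤ (vertices (suc q)) full'))
                                                       (inDegree≡2⇒regular⊤ (layer q) (bothOnto⇒inDegree≡2 (layer q) onto₀ onto₁)))

  private
    at-most-one-allowed : ∀ a j → constrained a j ≡ true → ind (allowed a j true) + ind (allowed a j false) ≤ 1
    at-most-one-allowed a j con rewrite con with permutes j true in perm₁ | permutes j false in perm₀
    ... | true  | true  = ⊥-elim (true≢false (trans (sym (proj₁ (∧-true⁻ (proj₁ (∧-true⁻ {fixedNonRegular j} con)))))
                                                     (permutes-both⇒regular j perm₁ perm₀)))
    ... | true  | false = ≤-refl
    ... | false | true  = ≤-refl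
    ... | false | false = z≤n

  exceptionalAt-count : ∀ a → sumList (λ y → ind (exceptionalAt a y)) (allVecs n) * 2 ^ s ≤ 2 ^ n
  exceptionalAt-count a = begin
    sumList (λ y → ind (exceptionalAt a y)) (allVecs n) * 2 ^ s  ≡⟨ cong (_* 2 ^ s) (sumList-ind-∧ (does (s ≤? C)) _ (allVecs n)) ⟩
    ind (does (s ≤? C)) * A * 2 ^ s                              ≤⟨ guarded (s ≤? C) ⟩
    2 ^ n ∎
    where
    open ≤-Reasoning
    C = countRange (constrained a) 0 n
    A = sumList (λ y → ind (admissible (allowed a) 0 y)) (allVecs n)
    guarded : (s≤C? : Dec (s ≤ C)) → ind (does s≤C?) * A * 2 ^ s ≤ 2 ^ n
    guarded (no _)    = z≤n
    guarded (yes s≤C) = begin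
      1 * A * 2 ^ s ≡⟨ cong (_* 2 ^ s) (*-identityˡ A) ⟩
      A * 2 ^ s     ≤⟨ *-monoʳ-≤ A (^-monoʳ-≤ 2 s≤C) ⟩
      A * 2 ^ C     ≤⟨ admissible-count n 0 (allowed a) (constrained a) (at-most-one-allowed a) ⟩
      2 ^ n ∎

  exceptional-count : sumList (λ y → ind (not (good y))) (allVecs n) * 2 ^ s ≤ n * 2 ^ n
  exceptional-count = begin
    sumList (λ y → ind (not (good y))) (allVecs n) * 2 ^ s
      ≤⟨ *-monoˡ-≤ (2 ^ s) (sumList-mono (allVecs n) (λ y → ind-nonzero (countRange (λ a → exceptionalAt a y) 0 n))) ⟩
    sumList (λ y → countRange (λ a → exceptionalAt a y) 0 n) (allVecs n) * 2 ^ s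
      ≡⟨ cong (_* 2 ^ s) (sumList-sumRange (λ a y → ind (exceptionalAt a y)) (allVecs n) 0 n) ⟩
    sumRange (λ a → sumList (λ y → ind (exceptionalAt a y)) (allVecs n)) 0 n * 2 ^ s
      ≤⟨ sumRange-bound _ (2 ^ s) (2 ^ n) 0 n exceptionalAt-count ⟩
    n * 2 ^ n ∎
    where
    open ≤-Reasoning
    ind-nonzero : ∀ c → ind (not (c ≡ᵇ 0)) ≤ c
    ind-nonzero zero    = z≤n
    ind-nonzero (suc c) = s≤s z≤n

  constrained-count : ∀ a d → countRange (constrained a) a d ≡ s ⊓ countRange fixedNonRegular a d
  constrained-count a zero    = sym (⊓-zeroʳ s)
  constrained-count a (suc d) = begin
    countRange (constrained a) a (suc d)                                        ≡⟨ sumRange-suc _ a d ⟩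
    countRange (constrained a) a d + ind (constrained a (a + d))                ≡⟨ cong₂ _+_ (constrained-count a d) (cong ind last) ⟩
    s ⊓ c + ind (fixedNonRegular (a + d) ∧ does (c <? s))                       ≡⟨ capped (fixedNonRegular (a + d)) ⟩
    s ⊓ (c + ind (fixedNonRegular (a + d)))                                     ≡⟨ cong (s ⊓_) (sym (sumRange-suc _ a d)) ⟩
    s ⊓ countRange fixedNonRegular a (suc d) ∎
    where
    open ≡-Reasoning
    c = countRange fixedNonRegular a d
    last : constrained a (a + d) ≡ fixedNonRegular (a + d) ∧ does (c <? s)
    last rewrite dec-true (a ≤? a + d) (m≤m+n a d) | m+n∸m≡n a d = refl
    capped : ∀ b → s ⊓ c + ind (b ∧ does (c <? s)) ≡ s ⊓ (c + ind b)
    capped false = trans (+-identityʳ _) (cong (s ⊓_) (sym (+-identityʳ c)))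
    capped true = step (c <? s)
      where
      step : (c<s? : Dec (c < s)) → s ⊓ c + ind (does c<s?) ≡ s ⊓ (c + 1)
      step (yes c<s) = trans (cong (_+ 1) (m≥n⇒m⊓n≡n (<⇒≤ c<s))) (sym (m≥n⇒m⊓n≡n (subst (_≤ s) (+-comm 1 c) c<s)))
      step (no  c≮s) =
        trans (+-identityʳ _) (trans (m≤n⇒m⊓n≡m (≮⇒≥ c≮s)) (sym (m≤n⇒m⊓n≡m (≤-trans (≮⇒≥ c≮s) (m≤m+n c 1)))))

module GoodInput {n} (B : OBP n) (wf : WellFormed B) (g : Fin n → Bool) (s : ℕ) (1≤s : 1 ≤ s)
                 (x : Vec Bool n) (isGood : ExceptionalInputs.good B g s x ≡ true) where
  open ProgramView B
  open RestrictionView B wf g x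
  open ExceptionalInputs B g s

  FullRun : ℕ → ℕ → Set
  FullRun a d = ∀ j → a ≤ j → j ≤ a + d → isFull (reach j) ≡ true

  not-exceptional : ∀ a → a < n → exceptionalAt a x ≡ false
  not-exceptional a a<n =
    countRange≡0 (λ a → exceptionalAt a x) 0 n (≡ᵇ⇒≡ _ 0 (subst T (sym isGood) _)) a (z≤n , a<n)

  run-permutes : ∀ a d → a + d ≤ n → FullRun a d → ∀ j → InRange a d j → fixedNonRegular j ≡ true → permutes j (bit j) ≡ true
  run-permutes a d a+d≤n run j (a≤j , j<a+d) fnr =
    cong₂ _∧_ (cong isFull (full-reach⇒vertices≡⊤ j (≤-trans (<⇒≤ j<a+d) a+d≤n) full))
              (cong₂ _∧_ (cong isFull (full-reach⇒vertices≡⊤ (suc j) (≤-trans j<a+d a+d≤n) full')) onto)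
    where
    full  = run j a≤j (<⇒≤ j<a+d)
    full' = run (suc j) (m≤n⇒m≤1+n a≤j) j<a+d
    fixed : free j ≡ false
    fixed = not-injective (proj₂ (∧-true⁻ {nonRegular j} fnr))
    onto : Onto (fixedMap j)
    onto = subst (λ R → isFull (image R (fixedMap j)) ≡ true) (isFull⇒≡⊤ (reach j) full)
             (subst (λ R → isFull R ≡ true) (reach-fixed j fixed) full')

  -- Otherwise x would be exceptional at the start of the run.
  fixed-in-run<s : ∀ a d → a + d ≤ n → FullRun a d → countRange fixedNonRegular a d < s
  fixed-in-run<s a d a+d≤n run with countRange fixedNonRegular a d <? s
  ... | yes lt = lt
  ... | no  ≮s = ⊥-elim (true≢false (trans (sym exceptional) (not-exceptional a a<n)))
    where
    s≤ : s ≤ countRange fixedNonRegular a d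
    s≤ = ≮⇒≥ ≮s
    a<n : a < n
    a<n = <-≤-trans (m<m+n a (≤-trans 1≤s (≤-trans s≤ (countRange≤ fixedNonRegular a d)))) a+d≤n
    enough : s ≤ countRange (constrained a) 0 n
    enough = begin
      s                                             ≡⟨ sym (m≤n⇒m⊓n≡m s≤) ⟩
      s ⊓ countRange fixedNonRegular a d            ≡⟨ sym (constrained-count a d) ⟩
      countRange (constrained a) a d                ≤⟨ countRange-⊆ (constrained a) a d n a+d≤n ⟩
      countRange (constrained a) 0 n ∎
      where open ≤-Reasoning
    allowed-bit : ∀ j → allowed a j (bit j) ≡ true
    allowed-bit j with constrained a j in con
    ... | false = refl
    ... | true with ∧-true⁻ {fixedNonRegular j} con
    ...   | fnr , rest with ∧-true⁻ {does (a ≤? j)} rest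
    ...     | a≤j? , early = run-permutes a d a+d≤n run j (a≤j , j<a+d) fnr
      where
      a≤j = witness (a ≤? j) a≤j?
      j<a+d : j < a + d
      j<a+d with (j ∸ a) <? d
      ... | yes j∸a<d = subst (_< a + d) (m+[n∸m]≡n a≤j) (+-monoʳ-< a j∸a<d)
      ... | no  j∸a≮d = ⊥-elim (<⇒≱ (witness (_ <? s) early) (≤-trans s≤ (countRange-monoʳ fixedNonRegular a (≮⇒≥ j∸a≮d))))
    exceptional : exceptionalAt a x ≡ true
    exceptional = cong₂ _∧_ (dec-true (s ≤? _) enough)
      (admissible-intro (allowed a) 0 x (λ i →
        subst (λ b → allowed a (toℕ i) b ≡ true) (sym (lookup≡lookupOr x false i)) (allowed-bit (toℕ i))))

  freeNonRegular : ℕ → Bool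
  freeNonRegular j = nonRegular j ∧ free j

  Run : ℕ → ℕ → Set
  Run q c = Σ[ a ∈ ℕ ] Σ[ d ∈ ℕ ] a + d ≡ q × FullRun a d × c ≡ countRange freeNonRegular a d

  private
    run-start : ∀ q → isFull (reach q) ≡ true → Run q 0
    run-start q full = q , 0 , +-identityʳ q , start , refl
      where
      start : FullRun q 0
      start j q≤j j≤q+0 = subst (λ i → isFull (reach i) ≡ true) (≤-antisym q≤j (subst (j ≤_) (+-identityʳ q) j≤q+0)) full

    run-extend : ∀ q c → Run q c → isFull (reach (suc q)) ≡ true → Run (suc q) (c + ind (freeNonRegular q))
    run-extend q c (a , d , refl , run , count) full' =
      a , suc d , +-suc a d , extended , trans (cong (_+ ind (freeNonRegular (a + d))) count) (sym (sumRange-suc _ a d))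
      where
      extended : FullRun a (suc d)
      extended j a≤j j≤ with j ≤? a + d
      ... | yes j≤a+d = run j a≤j j≤a+d
      ... | no  j≰a+d = subst (λ i → isFull (reach i) ≡ true) (≤-antisym (≰⇒> j≰a+d) (subst (j ≤_) (+-suc a d) j≤)) full'

  freeRun-run : ∀ q → freeRun q ≡ 0 ⊎ Run q (freeRun q)
  freeRun-run zero = inj₁ refl
  freeRun-run (suc q) with isFull (reach q) in full | isFull (reach (suc q)) in full'
  ... | false | _     = inj₁ refl
  ... | true  | false = inj₁ refl
  ... | true  | true  with freeRun-run q
  ...   | inj₁ none = inj₂ (subst (λ c → Run (suc q) (c + ind (freeNonRegular q))) (sym none) (run-extend q 0 (run-start q full) full'))
  ...   | inj₂ run  = inj₂ (run-extend q (freeRun q) run full')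

balance⇒bound : ∀ k ℓ M f e → 1 ≤ M → f * M ≤ k * (e + M) → e < ℓ * M → f ≤ k * suc ℓ
balance⇒bound k ℓ M@(suc _) f e _ balance e<ℓM = *-cancelʳ-≤ f (k * suc ℓ) M (begin
  f * M             ≤⟨ balance ⟩
  k * (e + M)       ≤⟨ *-monoʳ-≤ k (+-monoˡ-≤ M (<⇒≤ e<ℓM)) ⟩
  k * (ℓ * M + M)   ≡⟨ rearrange k ℓ M ⟩
  k * suc ℓ * M ∎)
  where
  open ≤-Reasoning
  rearrange : ∀ k ℓ M → k * (ℓ * M + M) ≡ k * (1 + ℓ) * M
  rearrange = solve-∀

k[ℓ+1]+2≤6ℓk : ∀ k ℓ → 1 ≤ k → 1 ≤ ℓ → k * suc ℓ + 2 ≤ 6 * ℓ * k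
k[ℓ+1]+2≤6ℓk k ℓ 1≤k 1≤ℓ = begin
  k * suc ℓ + 2               ≡⟨ expand k ℓ ⟩
  k + k * ℓ + 2               ≤⟨ +-mono-≤ (+-monoˡ-≤ (k * ℓ) (m≤m*n k ℓ)) (*-monoʳ-≤ 2 (*-mono-≤ 1≤k 1≤ℓ)) ⟩
  k * ℓ + k * ℓ + 2 * (k * ℓ) ≤⟨ m≤m+n _ (2 * (k * ℓ)) ⟩
  k * ℓ + k * ℓ + 2 * (k * ℓ) + 2 * (k * ℓ) ≡⟨ collect k ℓ ⟩
  6 * ℓ * k ∎
  where
  open ≤-Reasoning
  instance _ = >-nonZero 1≤ℓ
  expand : ∀ k ℓ → k * (1 + ℓ) + 2 ≡ k + k * ℓ + 2
  expand = solve-∀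
  collect : ∀ k ℓ → k * ℓ + k * ℓ + 2 * (k * ℓ) + 2 * (k * ℓ) ≡ 6 * ℓ * k
  collect = solve-∀

module ChunkRestriction {n l} (B : OBP n) (wf : WellFormed B) (D : ChunkDecomposition B l) (m : ℕ) (t : Subset (suc m)) (ℓ : ℕ) where

  M : ℕ
  M = suc m ∸ ∣ t ∣

  s : ℕ
  s = ℓ * M

  K : ℕ
  K = ∣ t ∣ * suc ℓ

  g : Fin n → Bool
  g = gₜ D (suc m) t

  open ExceptionalInputs B g s using (exceptional-count)
  open ExceptionalInputs B g s public using (good)

  module _ (1≤ℓ : 1 ≤ ℓ) (1≤M : 1 ≤ M) (x : Vec Bool n) (isGood : good x ≡ true) where
    open RestrictionView B wf g x using (freeRun; module Simulation)
    open GoodInput B wf g s (*-mono-≤ 1≤ℓ 1≤M) x isGood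
    open FreeBalance B D m t using (free-fixed-balance)

    freeRun≤K : ∀ q → q ≤ n → freeRun q ≤ K
    freeRun≤K q q≤n with freeRun-run q
    ... | inj₁ none = ≤-trans (≤-reflexive none) z≤n
    ... | inj₂ (a , d , refl , run , count) = subst (_≤ K) (sym count)
      (balance⇒bound ∣ t ∣ ℓ M _ _ 1≤M (free-fixed-balance a d q≤n) (fixed-in-run<s a d q≤n run))

    good⇒splits : 1 ≤ ∣ t ∣ → 1 ≤ n → Splits n (6 * ℓ * ∣ t ∣) (restrict B g x)
    good⇒splits 1≤k 1≤n = splits K (OBP.V₀ B) (restrictLayers B g x) counterBounded n (6 * ℓ * ∣ t ∣)
      (length-phase₁ (λ u → u) (OBP.V₀ B) (OBP.layers B) _ x) 1≤n (k[ℓ+1]+2≤6ℓk ∣ t ∣ ℓ 1≤k 1≤ℓ)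
      where open Simulation K freeRun≤K

  degenerate-count : 1 ≤ n → ¬ 1 ≤ M → 2 ^ n * 2 ^ s ≤ 0 * 2 ^ s + n * 2 ^ n
  degenerate-count 1≤n M≱1 rewrite n<1⇒n≡0 (≰⇒> M≱1) | *-zeroʳ ℓ = ≤-trans (≤-reflexive (*-identityʳ (2 ^ n))) (m≤n*m (2 ^ n) n)
    where instance _ = >-nonZero 1≤n

  goodInputs : List (Vec Bool n)
  goodInputs = filter (λ y → T? (good y)) (allVecs n)

  goodInputs-unique : Unique goodInputs
  goodInputs-unique = Unique.filter⁺ (λ y → T? (good y)) (allVecs-unique n)

  goodInputs-good : All (λ y → good y ≡ true) goodInputs
  goodInputs-good = All.map (Equivalence.to T-≡) (All.all-filter (λ y → T? (good y)) (allVecs n))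

  goodInputs-count : 2 ^ n * 2 ^ s ≤ length goodInputs * 2 ^ s + n * 2 ^ n
  goodInputs-count = begin
    2 ^ n * 2 ^ s                 ≡⟨ cong (_* 2 ^ s) (sym (trans (sumList-ind-+-not good (allVecs n)) (length-allVecs n))) ⟩
    (#good + #bad) * 2 ^ s        ≡⟨ *-distribʳ-+ (2 ^ s) #good #bad ⟩
    #good * 2 ^ s + #bad * 2 ^ s  ≤⟨ +-monoʳ-≤ (#good * 2 ^ s) exceptional-count ⟩
    #good * 2 ^ s + n * 2 ^ n     ≡⟨ cong (λ c → c * 2 ^ s + n * 2 ^ n) (sym (length-filter≡sumList good (allVecs n))) ⟩
    length goodInputs * 2 ^ s + n * 2 ^ n ∎
    where
    open ≤-Reasoning
    #good = sumList (λ y → ind (good y)) (allVecs n)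
    #bad  = sumList (λ y → ind (not (good y))) (allVecs n)

lemma3p4 : ∀ {n l : ℕ} (B : OBP n) → WellFormed B → (D : ChunkDecomposition B l)
    → (k ℓ m : ℕ) → 1 ≤ k → k ≤ n → 1 ≤ ℓ → ℓ ≤ n → k ≤ m
    → (t : Subset m) → ∣ t ∣ ≡ k
    → ∃ λ (xs : List (Vec Bool n))
        → Unique xs
        × All (λ x → Splits n (6 * ℓ * k) (restrict B (gₜ D m t) x)) xs
        × 2 ^ n * 2 ^ (ℓ * (m ∸ k)) ≤ length xs * 2 ^ (ℓ * (m ∸ k)) + n * 2 ^ n
lemma3p4 B wf D k ℓ zero    1≤k _   _   _ k≤0 t _ = ⊥-elim (<⇒≱ 1≤k k≤0)
lemma3p4 B wf D _ ℓ (suc m) 1≤k k≤n 1≤ℓ _ _ t refl with 1 ≤? ChunkRestriction.M B wf D m t ℓ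
... | yes 1≤M = goodInputs , goodInputs-unique
              , All.map (λ {x} isGood → good⇒splits 1≤ℓ 1≤M x isGood 1≤k (≤-trans 1≤k k≤n)) goodInputs-good
              , goodInputs-count
  where open ChunkRestriction B wf D m t ℓ
... | no  M≱1 = [] , AllPairs.[] , All.[] , ChunkRestriction.degenerate-count B wf D m t ℓ (≤-trans 1≤k k≤n) M≱1
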